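{- Let $K$ be a quartic CM field with real quadratic subfield $F$, fix $\gamma\in\mathcal{O}_K$ with $\mathcal{O}_K=\mathcal{O}_F[\gamma]$, and let $T$ be a set of representatives, modulo translation by integers, of the $\eta \in \mathcal{O}_F$ with $\mathbb{Z}[\eta] = \mathcal{O}_F$ (so $\#T=2$). Let $W$ be the set of Weil generators for $K$. For $u \in \mathcal{O}_F^\times$ and $\eta \in T$, put $\Omega(u,\eta) = \frac{u(\gamma - \overline{\gamma}) + \eta}{2}$, let $a(u,\eta)$ be the unique element of $\frac12\mathbb{Z}$ such that $\operatorname{Norm}_{K/F}\!\left(\Omega(u,\eta) + \frac{a(u,\eta)}{2}\right) \in \mathbb{Q}$, and put $\alpha(u,\eta) = \Omega(u,\eta) + \frac{a(u,\eta)}{2}$. Then for $u\in\mathcal{O}_F^\times$ and $\eta\in T$: $\alpha(u,\eta) \in W$ if and only if $\alpha(u',\eta') \in W$ for all $u'\in\{u,-u\}$ and all $\eta' \in T$.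
   Context: For a CM field $K$ with complex conjugation $\alpha\mapsto\overline{\alpha}$, $\alpha \in \mathcal{O}_K$ is a Weil generator for $K$ if $\alpha\overline{\alpha} \in \mathbb{Z}$ and $\mathbb{Z}[\alpha,\overline{\alpha}] = \mathcal{O}_K$. -}

module Defs where

open import Data.Nat as ℕ using (ℕ)
open import Data.Integer as ℤ using (ℤ)
open import Data.Rational as ℚ using (ℚ; 0ℚ; 1ℚ; _/_)
open import Data.Product using (Σ; ∃; ∃-syntax; _×_; _,_; proj₁; proj₂)
open import Data.List using (List; []; _∷_; length; foldr)
open import Data.List.Relation.Unary.All using (All)
open import Relation.Binary.PropositionalEquality using (_≡_)

-- Elements of F = ℚ(√d) are pairs (a , b) meaning a + b√d.
FQ : Set
FQ = ℚ × ℚ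

-- Elements of K = F(√δ) are pairs (x , y) of elements of F meaning x + y√δ.
KQ : Set
KQ = FQ × FQ

module CM (d : ℕ) (δ : FQ) where

  dq : ℚ
  dq = ℤ.+ d / 1

  _+F_ : FQ → FQ → FQ
  (a , b) +F (c , e) = (a ℚ.+ c , b ℚ.+ e)

  _*F_ : FQ → FQ → FQ
  (a , b) *F (c , e) = (a ℚ.* c ℚ.+ dq ℚ.* (b ℚ.* e) , a ℚ.* e ℚ.+ b ℚ.* c)

  -F_ : FQ → FQ
  -F (a , b) = (ℚ.- a , ℚ.- b)

  0F : FQ
  0F = (0ℚ , 0ℚ)

  _+K_ : KQ → KQ → KQ
  (x , y) +K (z , w) = (x +F z , y +F w)

  _*K_ : KQ → KQ → KQ
  (x , y) *K (z , w) = ((x *F z) +F (δ *F (y *F w)) , (x *F w) +F (y *F z))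

  -K_ : KQ → KQ
  -K (x , y) = (-F x , -F y)

  _-K_ : KQ → KQ → KQ
  α -K β = α +K (-K β)

  ιQ : ℚ → KQ
  ιQ q = ((q , 0ℚ) , 0F)

  ιZ : ℤ → KQ
  ιZ n = ιQ (n / 1)

  0K : KQ
  0K = ιQ 0ℚ

  1K : KQ
  1K = ιQ 1ℚ

  half : KQ → KQ
  half α = ιQ (ℤ.+ 1 / 2) *K α

  -- complex conjugation: the nontrivial automorphism of K over F
  conj : KQ → KQ
  conj (x , y) = (x , -F y)

  _^K_ : KQ → ℕ → KQ
  α ^K ℕ.zero = 1K
  α ^K ℕ.suc n = α *K (α ^K n)

  -- Σ_i c_i α^i  for a coefficient list (c_0 , c_1 , …)
  evalZ : List ℤ → KQ → KQ
  evalZ cs α = foldr (λ c acc → ιZ c +K (α *K acc)) 0K cs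

  evalK : List KQ → KQ → KQ
  evalK cs α = foldr (λ c acc → c +K (α *K acc)) 0K cs

  eval2 : List (ℤ × ℕ × ℕ) → KQ → KQ → KQ
  eval2 ts α β = foldr (λ { (c , i , j) acc → (ιZ c *K ((α ^K i) *K (β ^K j))) +K acc }) 0K ts

  -- α ∈ 𝒪_K : α is a root of a monic polynomial with integer coefficients
  -- X^n + c_{n-1} X^{n-1} + … + c_0 , cs = (c_0 , … , c_{n-1})
  InOK : KQ → Set
  InOK α = Σ (List ℤ) λ cs → (α ^K length cs) +K evalZ cs α ≡ 0K

  InF : KQ → Set
  InF α = proj₂ α ≡ 0F

  InOF : KQ → Set
  InOF α = InF α × InOK α

  InZ : KQ → Set
  InZ α = ∃[ n ] α ≡ ιZ n

  InQ : KQ → Set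
  InQ α = ∃[ q ] α ≡ ιQ q

  UnitF : KQ → Set
  UnitF u = InOF u × ∃[ v ] (InOF v × u *K v ≡ 1K)

  GeneratesOF : KQ → Set
  GeneratesOF η = InOF η × (∀ β → InOF β → ∃[ cs ] evalZ cs η ≡ β)

  GeneratesOKoverOF : KQ → Set
  GeneratesOKoverOF γ =
    InOK γ × (∀ β → InOK β → Σ (List KQ) λ cs → All InOF cs × evalK cs γ ≡ β)

  Weil : KQ → Set
  Weil α = InOK α × InZ (α *K conj α)
         × (∀ β → InOK β → ∃[ ts ] eval2 ts α (conj α) ≡ β)

  IsRepSet : (KQ → Set) → Set
  IsRepSet T =
      (∀ η → T η → GeneratesOF η)
    × (∀ η → GeneratesOF η → ∃[ η' ] (T η' × ∃[ n ] η ≡ η' +K ιZ n))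
    × (∀ η η' → T η → T η' → (∃[ n ] η ≡ η' +K ιZ n) → η ≡ η')

  NormKF : KQ → KQ
  NormKF α = α *K conj α

  HalfInt : ℚ → Set
  HalfInt q = ∃[ m ] q ≡ m / 2

  Ω : KQ → KQ → KQ → KQ
  Ω γ u η = half ((u *K (γ -K conj γ)) +K η)

  -- α(u,η) = Ω(u,η) + a(u,η)/2 , with a(u,η) = A u η
  αf : KQ → (KQ → KQ → ℚ) → KQ → KQ → KQ
  αf γ A u η = Ω γ u η +K half (ιQ (A u η))

module Submission where

-- Only one direction has content. Let α = α(u, η) be a Weil generator, a = a(u, η).
--  * Weil generators are stable under x ↦ x̄ and x ↦ -x (WeilSymmetries): both maps
--    preserve integrality, the norm x x̄, and the generation of 𝒪_K by x and x̄.
--  * Ω(u, η) + s/2 has rational norm for at most one s (NormalisingConstant): the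
--    √d-coordinate of its norm is affine in s with slope the √d-coordinate of Ω(u, η),
--    i.e. of η/2, which is nonzero because a generator of 𝒪_F is irrational.
--  * Two generators of 𝒪_F satisfy η' = ±η + p with p ∈ ℤ (GeneratorsOfOF); in T the
--    sign + forces η' = η. This needs ℤ[η] = ℤ + ℤη, i.e. N(η), Tr(η) ∈ ℤ for η integral
--    over ℤ (IntegralElements), which holds because all powers of N(η) have a common
--    bounded denominator (IntegersInℚ.integral-if-powers-bounded).
--  * Conjugating and negating Ω(u, η) + a/2 gives Ω(-u, η) + a/2 and
--    Ω(-u, -η + p) + (-a - p)/2, whose norms are N(α) ∈ ℚ. By uniqueness,
--    α(-u, η) = ᾱ, α(u, -η + p) = -ᾱ and α(-u, -η + p) = -α, all Weil generators.

open import Defs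
open import Level using (0ℓ)
open import Algebra.Bundles using (CommutativeRing)
open import Algebra.Structures using (IsCommutativeRing)
open import Data.Nat using (ℕ)
open import Data.Integer as ℤ using (ℤ)
open import Data.Product using (∃-syntax; _×_; _,_; proj₁; proj₂)
open import Relation.Binary.PropositionalEquality


module QuadraticExtension
  {A : Set} {add mul : A → A → A} {neg : A → A} {zero one : A}
  (isCR : IsCommutativeRing _≡_ add mul neg zero one)
  (c : A) where

  baseRing : CommutativeRing 0ℓ 0ℓ
  baseRing = record { isCommutativeRing = isCR }

  open CommutativeRing baseRing
    using (_+_; _*_; -_; 0#; 1#; +-assoc; +-comm; +-identityˡ; +-identityʳ; -‿inverseˡ; -‿inverseʳ;
           zeroˡ; zeroʳ; *-comm; *-identityˡ; *-identityʳ; _-_; commutativeSemiring; ring)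
  open import Algebra.Properties.Ring ring using (-‿+-comm; -‿involutive; -‿distribˡ-*; -‿distribʳ-*; -0#≈0#)
  open import Algebra.Solver.Ring.NaturalCoefficients.Default commutativeSemiring using (solve; _:=_; _:+_; _:*_; con)

  E : Set
  E = A × A

  infixl 6 _+E_
  infixl 7 _*E_

  _+E_ : E → E → E
  (a , b) +E (a' , b') = (a + a' , b + b')

  _*E_ : E → E → E
  (a , b) *E (a' , b') = (a * a' + c * (b * b') , a * b' + b * a')

  -E_ : E → E
  -E (a , b) = (- a , - b)

  0E 1E : E
  0E = (0# , 0#)
  1E = (1# , 0#)

  +E-assoc : ∀ x y z → (x +E y) +E z ≡ x +E (y +E z)
  +E-assoc (a , b) (a' , b') (a'' , b'') = cong₂ _,_ (+-assoc a a' a'') (+-assoc b b' b'')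

  +E-comm : ∀ x y → x +E y ≡ y +E x
  +E-comm (a , b) (a' , b') = cong₂ _,_ (+-comm a a') (+-comm b b')

  +E-identityˡ : ∀ x → 0E +E x ≡ x
  +E-identityˡ (a , b) = cong₂ _,_ (+-identityˡ a) (+-identityˡ b)

  +E-identityʳ : ∀ x → x +E 0E ≡ x
  +E-identityʳ (a , b) = cong₂ _,_ (+-identityʳ a) (+-identityʳ b)

  -E-inverseˡ : ∀ x → (-E x) +E x ≡ 0E
  -E-inverseˡ (a , b) = cong₂ _,_ (-‿inverseˡ a) (-‿inverseˡ b)

  -E-inverseʳ : ∀ x → x +E (-E x) ≡ 0E
  -E-inverseʳ (a , b) = cong₂ _,_ (-‿inverseʳ a) (-‿inverseʳ b)

  *E-assoc : ∀ x y z → (x *E y) *E z ≡ x *E (y *E z)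
  *E-assoc (a , b) (a' , b') (a'' , b'') = cong₂ _,_
    (solve 7 (λ c a b a' b' a'' b'' →
        (a :* a' :+ c :* (b :* b')) :* a'' :+ c :* ((a :* b' :+ b :* a') :* b'')
     := a :* (a' :* a'' :+ c :* (b' :* b'')) :+ c :* (b :* (a' :* b'' :+ b' :* a''))) refl c a b a' b' a'' b'')
    (solve 7 (λ c a b a' b' a'' b'' →
        (a :* a' :+ c :* (b :* b')) :* b'' :+ (a :* b' :+ b :* a') :* a''
     := a :* (a' :* b'' :+ b' :* a'') :+ b :* (a' :* a'' :+ c :* (b' :* b''))) refl c a b a' b' a'' b'')

  *E-comm : ∀ x y → x *E y ≡ y *E x
  *E-comm (a , b) (a' , b') = cong₂ _,_
    (solve 5 (λ c a b a' b' → a :* a' :+ c :* (b :* b') := a' :* a :+ c :* (b' :* b)) refl c a b a' b')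
    (solve 4 (λ a b a' b' → a :* b' :+ b :* a' := a' :* b :+ b' :* a) refl a b a' b')

  *E-identityˡ : ∀ x → 1E *E x ≡ x
  *E-identityˡ (a , b) = cong₂ _,_
    (solve 3 (λ c a b → con 1 :* a :+ c :* (con 0 :* b) := a) refl c a b)
    (solve 2 (λ a b → con 1 :* b :+ con 0 :* a := b) refl a b)

  *E-distribˡ : ∀ x y z → x *E (y +E z) ≡ x *E y +E x *E z
  *E-distribˡ (a , b) (a' , b') (a'' , b'') = cong₂ _,_
    (solve 7 (λ c a b a' b' a'' b'' →
        a :* (a' :+ a'') :+ c :* (b :* (b' :+ b''))
     := (a :* a' :+ c :* (b :* b')) :+ (a :* a'' :+ c :* (b :* b''))) refl c a b a' b' a'' b'')
    (solve 6 (λ a b a' b' a'' b'' →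
        a :* (b' :+ b'') :+ b :* (a' :+ a'')
     := (a :* b' :+ b :* a') :+ (a :* b'' :+ b :* a'')) refl a b a' b' a'' b'')

  isCommutativeRing : IsCommutativeRing _≡_ _+E_ _*E_ -E_ 0E 1E
  isCommutativeRing = record
    { isRing = record
      { +-isAbelianGroup = record
        { isGroup = record
          { isMonoid = record
            { isSemigroup = record
              { isMagma = record { isEquivalence = isEquivalence ; ∙-cong = cong₂ _+E_ }
              ; assoc = +E-assoc }
            ; identity = +E-identityˡ , +E-identityʳ }
          ; inverse = -E-inverseˡ , -E-inverseʳ
          ; ⁻¹-cong = cong -E_ }
        ; comm = +E-comm }
      ; *-cong = cong₂ _*E_
      ; *-assoc = *E-assoc
      ; *-identity = *E-identityˡ , λ x → trans (*E-comm x 1E) (*E-identityˡ x)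
      ; distrib = *E-distribˡ , λ x y z → trans (*E-comm (y +E z) x)
                    (trans (*E-distribˡ x y z) (cong₂ _+E_ (*E-comm x y) (*E-comm x z))) }
    ; *-comm = *E-comm }

  commutativeRing : CommutativeRing 0ℓ 0ℓ
  commutativeRing = record { isCommutativeRing = isCommutativeRing }

  ιE : A → E
  ιE a = (a , 0#)

  ιE-+ : ∀ a b → ιE (a + b) ≡ ιE a +E ιE b
  ιE-+ a b = cong (a + b ,_) (sym (+-identityˡ 0#))

  ιE-* : ∀ a b → ιE (a * b) ≡ ιE a *E ιE b
  ιE-* a b = cong₂ _,_
    (begin
      a * b                     ≡⟨ +-identityʳ (a * b) ⟨
      a * b + 0#                ≡⟨ cong (a * b +_) (zeroʳ c) ⟨
      a * b + c * 0#            ≡⟨ cong (λ z → a * b + c * z) (zeroˡ 0#) ⟨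
      a * b + c * (0# * 0#)     ∎)
    (begin
      0#                        ≡⟨ +-identityˡ 0# ⟨
      0# + 0#                   ≡⟨ cong₂ _+_ (zeroʳ a) (zeroˡ b) ⟨
      a * 0# + 0# * b           ∎)
    where open ≡-Reasoning

  ιE-neg : ∀ a → ιE (- a) ≡ -E ιE a
  ιE-neg a = cong (- a ,_) (sym -0#≈0#)

  conjE : E → E
  conjE (a , b) = (a , - b)

  conjE-+ : ∀ x y → conjE (x +E y) ≡ conjE x +E conjE y
  conjE-+ (a , b) (a' , b') = cong (a + a' ,_) (sym (-‿+-comm b b'))

  conjE-* : ∀ x y → conjE (x *E y) ≡ conjE x *E conjE y
  conjE-* (a , b) (a' , b') = cong₂ _,_
    (cong (λ z → a * a' + c * z) (sym neg-*-neg))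
    (begin
      - (a * b' + b * a')          ≡⟨ -‿+-comm (a * b') (b * a') ⟨
      - (a * b') + - (b * a')      ≡⟨ cong₂ _+_ (-‿distribʳ-* a b') (-‿distribˡ-* b a') ⟩
      a * (- b') + (- b) * a'      ∎)
    where
    open ≡-Reasoning
    neg-*-neg : (- b) * (- b') ≡ b * b'
    neg-*-neg = begin
      (- b) * (- b')   ≡⟨ -‿distribʳ-* (- b) b' ⟨
      - ((- b) * b')   ≡⟨ cong -_ (-‿distribˡ-* b b') ⟨
      - (- (b * b'))   ≡⟨ -‿involutive (b * b') ⟩
      b * b'           ∎

  conjE-involutive : ∀ x → conjE (conjE x) ≡ x
  conjE-involutive (a , b) = cong (a ,_) (-‿involutive b)

  conjE-ιE : ∀ a → conjE (ιE a) ≡ ιE a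
  conjE-ιE a = cong (a ,_) -0#≈0#

  -E-conjE : ∀ x → x +E (-E conjE x) ≡ (0# , proj₂ x + proj₂ x)
  -E-conjE (a , b) = cong₂ _,_ (-‿inverseʳ a) (cong (b +_) (-‿involutive b))

  √c : E
  √c = (0# , 1#)

  √c-squared : √c *E √c ≡ ιE c
  √c-squared = cong₂ _,_
    (trans (cong₂ _+_ (zeroˡ 0#) (trans (cong (c *_) (*-identityˡ 1#)) (*-identityʳ c))) (+-identityˡ c))
    (trans (cong₂ _+_ (zeroˡ 1#) (zeroʳ 1#)) (+-identityˡ 0#))

  ιE-scale : ∀ a x → ιE a *E x ≡ (a * proj₁ x , a * proj₂ x)
  ιE-scale a (x , y) = cong₂ _,_
    (trans (cong (a * x +_) (trans (cong (c *_) (zeroˡ y)) (zeroʳ c))) (+-identityʳ (a * x)))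
    (trans (cong (a * y +_) (zeroˡ x)) (+-identityʳ (a * y)))

  ιE-injective : ∀ {a b} → ιE a ≡ ιE b → a ≡ b
  ιE-injective = cong proj₁

  normE : E → A
  normE (a , b) = a * a - c * (b * b)

  traceE : E → A
  traceE (a , b) = a + a

  *E-conjE : ∀ x → x *E conjE x ≡ ιE (normE x)
  *E-conjE (a , b) = cong₂ _,_
    (cong (a * a +_) (trans (cong (c *_) (sym (-‿distribʳ-* b b))) (sym (-‿distribʳ-* c (b * b)))))
    (begin
      a * (- b) + b * a     ≡⟨ cong₂ _+_ (-‿distribʳ-* a b) (*-comm a b) ⟨
      - (a * b) + a * b     ≡⟨ -‿inverseˡ (a * b) ⟩
      0#                    ∎)
    where open ≡-Reasoning

  +E-conjE : ∀ x → x +E conjE x ≡ ιE (traceE x)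
  +E-conjE (a , b) = cong (a + a ,_) (-‿inverseʳ b)

  normE-* : ∀ x y → normE (x *E y) ≡ normE x * normE y
  normE-* x y = ιE-injective (begin
    ιE (normE (x *E y))                        ≡⟨ *E-conjE (x *E y) ⟨
    (x *E y) *E conjE (x *E y)                 ≡⟨ cong ((x *E y) *E_) (conjE-* x y) ⟩
    (x *E y) *E (conjE x *E conjE y)           ≡⟨ interchange x y (conjE x) (conjE y) ⟩
    (x *E conjE x) *E (y *E conjE y)           ≡⟨ cong₂ _*E_ (*E-conjE x) (*E-conjE y) ⟩
    ιE (normE x) *E ιE (normE y)               ≡⟨ ιE-* (normE x) (normE y) ⟨
    ιE (normE x * normE y)                     ∎)
    where
    open ≡-Reasoning
    open import Algebra.Properties.CommutativeSemigroup (CommutativeRing.*-commutativeSemigroup commutativeRing)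
      using (interchange)


-- They are proved once, with the integer-coefficient ring solver, over an abstract
-- ring (which keeps the normalisation cheap), and then instantiated for F and K.
module CommutativeRingIdentities
  {A : Set} {add mul : A → A → A} {neg : A → A} {zero one : A}
  (isCR : IsCommutativeRing _≡_ add mul neg zero one)
  (fromℤ : ℤ → A)
  (fromℤ-+ : ∀ m n → fromℤ (m ℤ.+ n) ≡ add (fromℤ m) (fromℤ n))
  (fromℤ-* : ∀ m n → fromℤ (m ℤ.* n) ≡ mul (fromℤ m) (fromℤ n))
  (fromℤ-neg : ∀ m → fromℤ (ℤ.- m) ≡ neg (fromℤ m))
  (fromℤ-0 : fromℤ (ℤ.+ 0) ≡ zero)
  (fromℤ-1 : fromℤ (ℤ.+ 1) ≡ one)
  where

  open import Data.Maybe using (map)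
  open import Relation.Nullary.Decidable using (dec⇒maybe)
  open import Algebra.Solver.Ring.AlmostCommutativeRing using (fromCommutativeRing; _-Raw-AlmostCommutative⟶_)

  private
    R : CommutativeRing 0ℓ 0ℓ
    R = record { isCommutativeRing = isCR }

  open CommutativeRing R using (_+_; _*_; -_; _-_; 1#; distribʳ; *-identityˡ)

  private
    morphism : ℤ.+-*-rawRing -Raw-AlmostCommutative⟶ fromCommutativeRing R
    morphism = record
      { ⟦_⟧ = fromℤ ; +-homo = fromℤ-+ ; *-homo = fromℤ-* ; -‿homo = fromℤ-neg
      ; 0-homo = fromℤ-0 ; 1-homo = fromℤ-1 }

  open import Algebra.Solver.Ring ℤ.+-*-rawRing (fromCommutativeRing R) morphism
    (λ m n → map (cong fromℤ) (dec⇒maybe (m ℤ.≟ n)))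
    using (solve; _:=_; _:+_; _:*_; :-_; _:-_; con)

  neg-*-neg : ∀ x y → (- x) * (- y) ≡ x * y
  neg-*-neg = solve 2 (λ x y → (:- x) :* (:- y) := x :* y) refl

  neg-*-swap : ∀ x s p → (- x) * (s * p) ≡ (- s) * (x * p)
  neg-*-swap = solve 3 (λ x s p → (:- x) :* (s :* p) := (:- s) :* (x :* p)) refl

  negate-difference : ∀ h u g g' n → h * ((u * (g' - g)) + n) ≡ h * (((- u) * (g - g')) + n)
  negate-difference = solve 5 (λ h u g g' n → h :* (u :* (g' :- g) :+ n) := h :* ((:- u) :* (g :- g') :+ n)) refl

  alternate-step : ∀ s c x e → s * c + (- x) * ((- s) * e) ≡ s * (c + x * e)
  alternate-step = solve 4 (λ s c x e → s :* c :+ (:- x) :* ((:- s) :* e) := s :* (c :+ x :* e)) refl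

  regroup-scalars : ∀ c a b x y → c * ((a * x) * (b * y)) ≡ ((c * a) * b) * (x * y)
  regroup-scalars = solve 5 (λ c a b x y → c :* ((a :* x) :* (b :* y)) := ((c :* a) :* b) :* (x :* y)) refl

  horner-step : ∀ x c e y → x * (c + e * y) ≡ c * x + (e * x) * y
  horner-step = solve 4 (λ x c e y → x :* (c :+ e :* y) := c :* x :+ (e :* x) :* y) refl

  horner-+ : ∀ c c' e y y' → (c + c') + e * (y + y') ≡ (c + e * y) + (c' + e * y')
  horner-+ = solve 5 (λ c c' e y y' → (c :+ c') :+ e :* (y :+ y') := (c :+ e :* y) :+ (c' :+ e :* y')) refl

  shift-* : ∀ e p → (e + 1#) * p ≡ e * p + p
  shift-* e p = trans (distribʳ p e 1#) (cong (e * p +_) (*-identityˡ p))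

  -- Cayley–Hamilton for e with conjugate ē: e² = (e + ē) e - e ē
  cayley-hamilton : ∀ c p q e ē → c + e * (p + q * e) ≡ (c - q * (e * ē)) + (p + q * (e + ē)) * e
  cayley-hamilton = solve 5 (λ c p q e ē →
    c :+ e :* (p :+ q :* e) := (c :- q :* (e :* ē)) :+ (p :+ q :* (e :+ ē)) :* e) refl

  -- N(e + 1) = N(e) + Tr(e) + 1, solved for Tr(e) by cancel-shift
  norm-shift : ∀ e ē → (e + 1#) * (ē + 1#) ≡ (e * ē + (e + ē)) + 1#
  norm-shift e ē = subst (λ u → (e + u) * (ē + u) ≡ (e * ē + (e + ē)) + u) fromℤ-1
    (solve 2 (λ e ē → (e :+ con (ℤ.+ 1)) :* (ē :+ con (ℤ.+ 1)) := (e :* ē :+ (e :+ ē)) :+ con (ℤ.+ 1)) refl e ē)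

  scaled-norm : ∀ D c a b → (D * D) * (a * a - c * (b * b)) ≡ (D * a) * (D * a) - c * ((D * b) * (D * b))
  scaled-norm = solve 4 (λ D c a b →
    (D :* D) :* (a :* a :- c :* (b :* b)) := (D :* a) :* (D :* a) :- c :* ((D :* b) :* (D :* b))) refl

  cancel-shift : ∀ n t u → ((n + t) + u + (- n)) + (- u) ≡ t
  cancel-shift = solve 3 (λ n t u → ((n :+ t) :+ u :+ (:- n)) :+ (:- u) := t) refl

  -- evaluating the monic relation X² - r at x
  square-root-relation : ∀ x r → x * (x * fromℤ (ℤ.+ 1)) + ((- r) + x * (fromℤ (ℤ.+ 0) + x * fromℤ (ℤ.+ 0))) ≡ x * x - r
  square-root-relation = solve 2 (λ x r →
    x :* (x :* con (ℤ.+ 1)) :+ ((:- r) :+ x :* (con (ℤ.+ 0) :+ x :* con (ℤ.+ 0))) := x :* x :- r) refl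

  norm-expansion : ∀ b b' t → (b + t) * (b' + t) ≡ (b * b' + t * (b + b')) + t * t
  norm-expansion = solve 3 (λ b b' t → (b :+ t) :* (b' :+ t) := (b :* b' :+ t :* (b :+ b')) :+ t :* t) refl

  -- (s/2)(b + b) = s b, with h = 1/2
  halve-double : ∀ h s b → (h * s) * (b + b) ≡ s * ((h + h) * b)
  halve-double = solve 3 (λ h s b → (h :* s) :* (b :+ b) := s :* ((h :+ h) :* b)) refl

  -- -(Ω(u, η) + a/2) = Ω(-u, -η + p) + (-a - p)/2, with h = 1/2 and w = γ - γ̄
  negate-candidate : ∀ h u w n p a → - (h * (u * w + n) + h * a) ≡ h * ((- u) * w + ((- n) + p)) + h * ((- a) + (- p))
  negate-candidate = solve 6 (λ h u w n p a →
    :- (h :* (u :* w :+ n) :+ h :* a) := h :* ((:- u) :* w :+ ((:- n) :+ p)) :+ h :* ((:- a) :+ (:- p))) refl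


module IntegersInℚ where
  open import Data.Nat as ℕ using (ℕ; zero; suc)
  import Data.Nat.Properties as ℕP
  open import Data.Nat.Divisibility as ND using (_∣_; divides)
  open import Data.Nat.Coprimality as NC using (Coprime)
  import Data.Integer.Properties as ℤP
  open import Data.Rational as ℚ using (ℚ; 0ℚ; 1ℚ; _/_; mkℚ; fromℚᵘ)
  import Data.Rational.Properties as ℚP
  import Data.Rational.Unnormalised as U
  import Data.Rational.Unnormalised.Properties as UP
  open import Data.Empty using (⊥-elim)

  ι : ℤ → ℚ
  ι z = z / 1

  IsInt : ℚ → Set
  IsInt x = ∃[ z ] x ≡ ι z

  fromℚᵘ-+ : ∀ x y → fromℚᵘ x ℚ.+ fromℚᵘ y ≡ fromℚᵘ (x U.+ y)
  fromℚᵘ-+ x y = ℚP.toℚᵘ-injective (UP.≃-trans (ℚP.toℚᵘ-homo-+ (fromℚᵘ x) (fromℚᵘ y))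
    (UP.≃-trans (UP.+-cong (ℚP.toℚᵘ-fromℚᵘ x) (ℚP.toℚᵘ-fromℚᵘ y)) (UP.≃-sym (ℚP.toℚᵘ-fromℚᵘ (x U.+ y)))))

  fromℚᵘ-* : ∀ x y → fromℚᵘ x ℚ.* fromℚᵘ y ≡ fromℚᵘ (x U.* y)
  fromℚᵘ-* x y = ℚP.toℚᵘ-injective (UP.≃-trans (ℚP.toℚᵘ-homo-* (fromℚᵘ x) (fromℚᵘ y))
    (UP.≃-trans (UP.*-cong (ℚP.toℚᵘ-fromℚᵘ x) (ℚP.toℚᵘ-fromℚᵘ y)) (UP.≃-sym (ℚP.toℚᵘ-fromℚᵘ (x U.* y)))))

  ι-+ : ∀ a b → ι (a ℤ.+ b) ≡ ι a ℚ.+ ι b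
  ι-+ a b = sym (trans (fromℚᵘ-+ (U.mkℚᵘ a 0) (U.mkℚᵘ b 0))
    (ℚP.fromℚᵘ-cong {U.mkℚᵘ a 0 U.+ U.mkℚᵘ b 0} {U.mkℚᵘ (a ℤ.+ b) 0}
      (U.*≡* (cong (ℤ._* ℤ.+ 1) (cong₂ ℤ._+_ (ℤP.*-identityʳ a) (ℤP.*-identityʳ b))))))

  ι-* : ∀ a b → ι (a ℤ.* b) ≡ ι a ℚ.* ι b
  ι-* a b = sym (fromℚᵘ-* (U.mkℚᵘ a 0) (U.mkℚᵘ b 0))

  ι-neg : ∀ a → ι (ℤ.- a) ≡ ℚ.- ι a
  ι-neg a = sym (ℚP.toℚᵘ-injective (UP.≃-trans (ℚP.toℚᵘ-homo‿- (ι a))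
    (UP.≃-trans (UP.-‿cong (ℚP.toℚᵘ-fromℚᵘ (U.mkℚᵘ a 0))) (UP.≃-sym (ℚP.toℚᵘ-fromℚᵘ (U.mkℚᵘ (ℤ.- a) 0))))))

  ι-injective : ∀ {a b} → ι a ≡ ι b → a ≡ b
  ι-injective {a} {b} eq with ℚP.fromℚᵘ-injective {U.mkℚᵘ a 0} {U.mkℚᵘ b 0} eq
  ... | U.*≡* e = trans (sym (ℤP.*-identityʳ a)) (trans e (ℤP.*-identityʳ b))

  *-cancelʳ : ∀ p q r → r ≢ 0ℚ → p ℚ.* r ≡ q ℚ.* r → p ≡ q
  *-cancelʳ p q r r≢0 pr≡qr = let instance _ = ℚ.≢-nonZero r≢0 in begin
      p                           ≡⟨ divide p ⟨
      (p ℚ.* r) ℚ.* ℚ.1/ r        ≡⟨ cong (ℚ._* ℚ.1/ r) pr≡qr ⟩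
      (q ℚ.* r) ℚ.* ℚ.1/ r        ≡⟨ divide q ⟩
      q                           ∎
    where
    open ≡-Reasoning
    divide : ∀ x → .{{_ : ℚ.NonZero r}} → (x ℚ.* r) ℚ.* ℚ.1/ r ≡ x
    divide x = trans (ℚP.*-assoc x r (ℚ.1/ r)) (trans (cong (x ℚ.*_) (ℚP.*-inverseʳ r)) (ℚP.*-identityʳ x))

  IsInt-+ : ∀ {a b} → IsInt a → IsInt b → IsInt (a ℚ.+ b)
  IsInt-+ (x , refl) (y , refl) = x ℤ.+ y , sym (ι-+ x y)

  IsInt-* : ∀ {a b} → IsInt a → IsInt b → IsInt (a ℚ.* b)
  IsInt-* (x , refl) (y , refl) = x ℤ.* y , sym (ι-* x y)

  IsInt-neg : ∀ {a} → IsInt a → IsInt (ℚ.- a)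
  IsInt-neg (x , refl) = ℤ.- x , sym (ι-neg x)

  denominator : ℚ → ℕ
  denominator (mkℚ _ s-1 _) = suc s-1

  numerator-eq : ∀ r s-1 .(c : Coprime ℤ.∣ r ∣ (suc s-1)) → mkℚ r s-1 c ℚ.* ι (ℤ.+ suc s-1) ≡ ι r
  numerator-eq r s-1 c = trans (cong (ℚ._* ι (ℤ.+ suc s-1)) (sym (ℚP.↥p/↧p≡p (mkℚ r s-1 c))))
     (trans (fromℚᵘ-* (U.mkℚᵘ r s-1) (U.mkℚᵘ (ℤ.+ suc s-1) 0))
       (ℚP.fromℚᵘ-cong {U.mkℚᵘ r s-1 U.* U.mkℚᵘ (ℤ.+ suc s-1) 0} {U.mkℚᵘ r 0} (U.*≡* eq)))
    where
    eq : (r ℤ.* ℤ.+ suc s-1) ℤ.* ℤ.+ 1 ≡ r ℤ.* ℤ.+ (suc s-1 ℕ.* 1)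
    eq = trans (ℤP.*-identityʳ _) (cong (λ m → r ℤ.* ℤ.+ m) (sym (ℕP.*-identityʳ (suc s-1))))

  IsInt-denominator : ∀ x → IsInt (ι (ℤ.+ denominator x) ℚ.* x)
  IsInt-denominator x@(mkℚ r s-1 c) = r , trans (ℚP.*-comm (ι (ℤ.+ suc s-1)) x) (numerator-eq r s-1 c)

  qpow : ℚ → ℕ → ℚ
  qpow x zero = 1ℚ
  qpow x (suc k) = x ℚ.* qpow x k

  zpow : ℤ → ℕ → ℤ
  zpow x zero = ℤ.+ 1
  zpow x (suc k) = x ℤ.* zpow x k

  ∣zpow∣ : ∀ x k → ℤ.∣ zpow x k ∣ ≡ ℤ.∣ x ∣ ℕ.^ k
  ∣zpow∣ x zero = refl
  ∣zpow∣ x (suc k) = trans (ℤP.abs-* x (zpow x k)) (cong (ℤ.∣ x ∣ ℕ.*_) (∣zpow∣ x k))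

  coprime-* : ∀ {a b c} → Coprime a b → Coprime a c → Coprime a (b ℕ.* c)
  coprime-* {a} {b} {c} ab ac {i} (i∣a , i∣bc) = ac (i∣a , NC.coprime-divisor ib i∣bc)
    where
    ib : Coprime i b
    ib (j∣i , j∣b) = ab (ND.∣-trans j∣i i∣a , j∣b)

  coprime-^ : ∀ {a b} k → Coprime a b → Coprime a (b ℕ.^ k)
  coprime-^ zero ab (_ , d∣1) = ND.∣1⇒≡1 d∣1
  coprime-^ (suc k) ab = coprime-* ab (coprime-^ k ab)

  n<s^n : ∀ s n → 2 ℕ.≤ s → n ℕ.< s ℕ.^ n
  n<s^n s zero le = ℕ.s≤s ℕ.z≤n
  n<s^n s (suc n) le = begin
      suc (suc n)             ≤⟨ ℕ.s≤s ih ⟩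
      suc (s ℕ.^ n)           ≡⟨ ℕP.+-comm 1 (s ℕ.^ n) ⟩
      s ℕ.^ n ℕ.+ 1           ≤⟨ ℕP.+-monoʳ-≤ (s ℕ.^ n) (ℕP.≤-trans (ℕ.s≤s ℕ.z≤n) ih) ⟩
      s ℕ.^ n ℕ.+ s ℕ.^ n     ≡⟨ cong (s ℕ.^ n ℕ.+_) (sym (ℕP.+-identityʳ (s ℕ.^ n))) ⟩
      2 ℕ.* s ℕ.^ n           ≤⟨ ℕP.*-monoˡ-≤ (s ℕ.^ n) le ⟩
      s ℕ.* s ℕ.^ n           ∎
    where
    open ℕP.≤-Reasoning
    ih = n<s^n s n le

  qpow-clear : ∀ x r s → x ℚ.* ι s ≡ ι r → ∀ k → qpow x k ℚ.* ι (zpow s k) ≡ ι (zpow r k)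
  qpow-clear x r s x·s≡r zero = refl
  qpow-clear x r s x·s≡r (suc k) = begin
      (x ℚ.* qpow x k) ℚ.* ι (s ℤ.* zpow s k)         ≡⟨ cong ((x ℚ.* qpow x k) ℚ.*_) (ι-* s (zpow s k)) ⟩
      (x ℚ.* qpow x k) ℚ.* (ι s ℚ.* ι (zpow s k))     ≡⟨ ℚP.*-assoc x (qpow x k) _ ⟩
      x ℚ.* (qpow x k ℚ.* (ι s ℚ.* ι (zpow s k)))     ≡⟨ cong (x ℚ.*_) (ℚP.*-comm (qpow x k) _) ⟩
      x ℚ.* ((ι s ℚ.* ι (zpow s k)) ℚ.* qpow x k)     ≡⟨ cong (x ℚ.*_) (ℚP.*-assoc (ι s) _ _) ⟩
      x ℚ.* (ι s ℚ.* (ι (zpow s k) ℚ.* qpow x k))     ≡⟨ ℚP.*-assoc x (ι s) _ ⟨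
      (x ℚ.* ι s) ℚ.* (ι (zpow s k) ℚ.* qpow x k)     ≡⟨ cong₂ ℚ._*_ x·s≡r (ℚP.*-comm (ι (zpow s k)) (qpow x k)) ⟩
      ι r ℚ.* (qpow x k ℚ.* ι (zpow s k))             ≡⟨ cong (ι r ℚ.*_) (qpow-clear x r s x·s≡r k) ⟩
      ι r ℚ.* ι (zpow r k)                            ≡⟨ ι-* r (zpow r k) ⟨
      ι (r ℤ.* zpow r k)                              ∎
    where open ≡-Reasoning

  -- Integrality criterion: if D·x^k is an integer for every k (with D > 0), then x is an integer.
  -- Otherwise x = r/s in lowest terms with s ≥ 2, and s^k would divide D for all k.
  integral-if-powers-bounded : ∀ x D → (∀ k → IsInt (ι (ℤ.+ suc D) ℚ.* qpow x k)) → IsInt x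
  integral-if-powers-bounded x@(mkℚ r zero c) D h = r , sym (ℚP.↥p/↧p≡p x)
  integral-if-powers-bounded x@(mkℚ r (suc s-2) c) D h =
    ⊥-elim (ℕP.<-irrefl refl (ℕP.<-≤-trans (n<s^n s k (ℕ.s≤s (ℕ.s≤s ℕ.z≤n))) (ND.∣⇒≤ s^k∣D)))
    where
    s = suc (suc s-2)
    k = suc D
    z = proj₁ (h k)
    D·xᵏ≡z : ι (ℤ.+ suc D) ℚ.* qpow x k ≡ ι z
    D·xᵏ≡z = proj₂ (h k)
    int-eq : ℤ.+ suc D ℤ.* zpow r k ≡ z ℤ.* zpow (ℤ.+ s) k
    int-eq = ι-injective (begin
      ι (ℤ.+ suc D ℤ.* zpow r k)                                  ≡⟨ ι-* (ℤ.+ suc D) (zpow r k) ⟩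
      ι (ℤ.+ suc D) ℚ.* ι (zpow r k)                              ≡⟨ cong (ι (ℤ.+ suc D) ℚ.*_) (qpow-clear x r (ℤ.+ s) (numerator-eq r (suc s-2) c) k) ⟨
      ι (ℤ.+ suc D) ℚ.* (qpow x k ℚ.* ι (zpow (ℤ.+ s) k))         ≡⟨ ℚP.*-assoc (ι (ℤ.+ suc D)) (qpow x k) _ ⟨
      (ι (ℤ.+ suc D) ℚ.* qpow x k) ℚ.* ι (zpow (ℤ.+ s) k)         ≡⟨ cong (ℚ._* ι (zpow (ℤ.+ s) k)) D·xᵏ≡z ⟩
      ι z ℚ.* ι (zpow (ℤ.+ s) k)                                  ≡⟨ ι-* z (zpow (ℤ.+ s) k) ⟨
      ι (z ℤ.* zpow (ℤ.+ s) k)                                    ∎)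
      where open ≡-Reasoning
    nat-eq : ℤ.∣ r ∣ ℕ.^ k ℕ.* suc D ≡ ℤ.∣ z ∣ ℕ.* s ℕ.^ k
    nat-eq = begin
      ℤ.∣ r ∣ ℕ.^ k ℕ.* suc D              ≡⟨ ℕP.*-comm _ (suc D) ⟩
      suc D ℕ.* ℤ.∣ r ∣ ℕ.^ k              ≡⟨ cong (suc D ℕ.*_) (∣zpow∣ r k) ⟨
      suc D ℕ.* ℤ.∣ zpow r k ∣             ≡⟨ ℤP.abs-* (ℤ.+ suc D) (zpow r k) ⟨
      ℤ.∣ ℤ.+ suc D ℤ.* zpow r k ∣         ≡⟨ cong ℤ.∣_∣ int-eq ⟩
      ℤ.∣ z ℤ.* zpow (ℤ.+ s) k ∣           ≡⟨ ℤP.abs-* z _ ⟩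
      ℤ.∣ z ∣ ℕ.* ℤ.∣ zpow (ℤ.+ s) k ∣     ≡⟨ cong (ℤ.∣ z ∣ ℕ.*_) (∣zpow∣ (ℤ.+ s) k) ⟩
      ℤ.∣ z ∣ ℕ.* s ℕ.^ k                  ∎
      where open ≡-Reasoning
    coprime : Coprime (s ℕ.^ k) (ℤ.∣ r ∣ ℕ.^ k)
    coprime = NC.sym (coprime-^ k (NC.sym (coprime-^ k (NC.sym (NC.recompute c)))))
    s^k∣D : s ℕ.^ k ∣ suc D
    s^k∣D = NC.coprime-divisor coprime (divides ℤ.∣ z ∣ nat-eq)

  module ℚ-ids = CommutativeRingIdentities ℚP.+-*-isCommutativeRing ι ι-+ ι-* ι-neg refl refl


module CMArithmetic (d : ℕ) (δ : FQ) where
  open import Data.Rational as ℚ using (ℚ)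
  import Data.Rational.Properties as ℚP
  open IntegersInℚ
  open CM d δ

  -- The operations of Defs are definitionally those of the quadratic extensions
  -- F = ℚ[√d] and K = F[√δ].
  module F = QuadraticExtension ℚP.+-*-isCommutativeRing dq
  module K = QuadraticExtension F.isCommutativeRing δ

  ½ : ℚ
  ½ = ℤ.+ 1 ℚ./ 2

  embF : FQ → KQ
  embF = K.ιE

  ιQ-+ : ∀ p q → ιQ (p ℚ.+ q) ≡ ιQ p +K ιQ q
  ιQ-+ p q = trans (cong K.ιE (F.ιE-+ p q)) (K.ιE-+ (F.ιE p) (F.ιE q))

  ιQ-* : ∀ p q → ιQ (p ℚ.* q) ≡ ιQ p *K ιQ q
  ιQ-* p q = trans (cong K.ιE (F.ιE-* p q)) (K.ιE-* (F.ιE p) (F.ιE q))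

  ιQ-neg : ∀ p → ιQ (ℚ.- p) ≡ -K ιQ p
  ιQ-neg p = trans (cong K.ιE (F.ιE-neg p)) (K.ιE-neg (F.ιE p))

  ιF : ℤ → FQ
  ιF z = F.ιE (ι z)

  ιF-+ : ∀ m n → ιF (m ℤ.+ n) ≡ ιF m +F ιF n
  ιF-+ m n = trans (cong F.ιE (ι-+ m n)) (F.ιE-+ (ι m) (ι n))

  ιF-* : ∀ m n → ιF (m ℤ.* n) ≡ ιF m *F ιF n
  ιF-* m n = trans (cong F.ιE (ι-* m n)) (F.ιE-* (ι m) (ι n))

  ιF-neg : ∀ m → ιF (ℤ.- m) ≡ -F ιF m
  ιF-neg m = trans (cong F.ιE (ι-neg m)) (F.ιE-neg (ι m))

  module F-ids = CommutativeRingIdentities F.isCommutativeRing ιF ιF-+ ιF-* ιF-neg refl refl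

  ιZ-+ : ∀ m n → ιZ (m ℤ.+ n) ≡ ιZ m +K ιZ n
  ιZ-+ m n = trans (cong ιQ (ι-+ m n)) (ιQ-+ (ι m) (ι n))

  ιZ-* : ∀ m n → ιZ (m ℤ.* n) ≡ ιZ m *K ιZ n
  ιZ-* m n = trans (cong ιQ (ι-* m n)) (ιQ-* (ι m) (ι n))

  ιZ-neg : ∀ m → ιZ (ℤ.- m) ≡ -K ιZ m
  ιZ-neg m = trans (cong ιQ (ι-neg m)) (ιQ-neg (ι m))

  module K-ids = CommutativeRingIdentities K.isCommutativeRing ιZ ιZ-+ ιZ-* ιZ-neg refl refl

  conj-+ : ∀ x y → conj (x +K y) ≡ conj x +K conj y
  conj-+ = K.conjE-+

  conj-* : ∀ x y → conj (x *K y) ≡ conj x *K conj y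
  conj-* = K.conjE-*

  conj-conj : ∀ x → conj (conj x) ≡ x
  conj-conj = K.conjE-involutive

  conj-embF : ∀ x → conj (embF x) ≡ embF x
  conj-embF = K.conjE-ιE

  conj-ιQ : ∀ q → conj (ιQ q) ≡ ιQ q
  conj-ιQ q = conj-embF (F.ιE q)

  NormKF-conj : ∀ x → NormKF (conj x) ≡ NormKF x
  NormKF-conj x = trans (cong (conj x *K_) (conj-conj x)) (K.*E-comm (conj x) x)

  NormKF-neg : ∀ x → NormKF (-K x) ≡ NormKF x
  NormKF-neg x = K-ids.neg-*-neg x (conj x)

  conj-Ω : ∀ γ u η → conj (Ω γ (embF u) (embF η)) ≡ Ω γ (-K embF u) (embF η)
  conj-Ω γ u η = begin
    conj (h *K ((U *K (γ -K conj γ)) +K N))                ≡⟨ conj-* h ((U *K (γ -K conj γ)) +K N) ⟩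
    conj h *K conj ((U *K (γ -K conj γ)) +K N)             ≡⟨ cong₂ _*K_ (conj-ιQ ½) (conj-+ (U *K (γ -K conj γ)) N) ⟩
    h *K (conj (U *K (γ -K conj γ)) +K conj N)             ≡⟨ cong (λ z → h *K (z +K conj N)) (conj-* U (γ -K conj γ)) ⟩
    h *K ((conj U *K conj (γ -K conj γ)) +K conj N)        ≡⟨ cong₂ (λ a b → h *K ((a *K conj (γ -K conj γ)) +K b)) (conj-embF u) (conj-embF η) ⟩
    h *K ((U *K conj (γ -K conj γ)) +K N)                  ≡⟨ cong (λ z → h *K ((U *K z) +K N)) (conj-+ γ (-K conj γ)) ⟩
    h *K ((U *K (conj γ +K (-K conj (conj γ)))) +K N)      ≡⟨ cong (λ z → h *K ((U *K (conj γ +K (-K z))) +K N)) (conj-conj γ) ⟩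
    h *K ((U *K (conj γ -K γ)) +K N)                       ≡⟨ K-ids.negate-difference h U γ (conj γ) N ⟩
    h *K (((-K U) *K (γ -K conj γ)) +K N)                  ∎
    where
    open ≡-Reasoning
    h = ιQ ½
    U = embF u
    N = embF η


module Signs where
  open import Data.Nat using (zero; suc)
  open import Data.List using (List; []; _∷_; length)
  import Data.Integer.Tactic.RingSolver as ℤSolver

  sgn : ℕ → ℤ
  sgn zero = ℤ.+ 1
  sgn (suc n) = ℤ.- sgn n

  sgn-sq : ∀ n → sgn n ℤ.* sgn n ≡ ℤ.+ 1
  sgn-sq zero = refl
  sgn-sq (suc n) = trans (neg-sq (sgn n)) (sgn-sq n)
    where
    neg-sq : ∀ s → (ℤ.- s) ℤ.* (ℤ.- s) ≡ s ℤ.* s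
    neg-sq = ℤSolver.solve-∀

  -- The coefficients (c₀, c₁, …) ↦ (s c₀, -s c₁, s c₂, …): from f(X) to s·f(-X).
  alternate : ℤ → List ℤ → List ℤ
  alternate s [] = []
  alternate s (c ∷ cs) = (s ℤ.* c) ∷ alternate (ℤ.- s) cs

  length-alternate : ∀ s cs → length (alternate s cs) ≡ length cs
  length-alternate s [] = refl
  length-alternate s (c ∷ cs) = cong suc (length-alternate (ℤ.- s) cs)

  -- The terms c Xⁱ Yʲ ↦ (-1)^(i+j) c Xⁱ Yʲ: from g(X, Y) to g(-X, -Y).
  alternateTerms : List (ℤ × ℕ × ℕ) → List (ℤ × ℕ × ℕ)
  alternateTerms [] = []
  alternateTerms ((c , i , j) ∷ ts) = ((c ℤ.* sgn i) ℤ.* sgn j , i , j) ∷ alternateTerms ts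

  alternate-coefficient : ∀ c i j → (((c ℤ.* sgn i) ℤ.* sgn j) ℤ.* sgn i) ℤ.* sgn j ≡ c
  alternate-coefficient c i j = begin
    (((c ℤ.* sgn i) ℤ.* sgn j) ℤ.* sgn i) ℤ.* sgn j   ≡⟨ regroup c (sgn i) (sgn j) ⟩
    c ℤ.* (sgn i ℤ.* sgn i) ℤ.* (sgn j ℤ.* sgn j)     ≡⟨ cong₂ (λ a b → c ℤ.* a ℤ.* b) (sgn-sq i) (sgn-sq j) ⟩
    c ℤ.* ℤ.+ 1 ℤ.* ℤ.+ 1                             ≡⟨ ℤSolver.solve (c ∷ []) ⟩
    c                                                  ∎
    where
    open ≡-Reasoning
    regroup : ∀ c a b → (((c ℤ.* a) ℤ.* b) ℤ.* a) ℤ.* b ≡ c ℤ.* (a ℤ.* a) ℤ.* (b ℤ.* b)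
    regroup = ℤSolver.solve-∀


module WeilSymmetries (d : ℕ) (δ : FQ) where
  open import Data.Nat using (zero; suc)
  open import Data.Rational using (0ℚ; 1ℚ)
  open import Data.List using ([]; _∷_; length)
  open IntegersInℚ
  open Signs
  open CM d δ
  open CMArithmetic d δ
  open CommutativeRing K.commutativeRing using (*-identityˡ; zeroʳ; distribˡ)

  conj-pow : ∀ α n → conj (α ^K n) ≡ conj α ^K n
  conj-pow α zero = conj-ιQ 1ℚ
  conj-pow α (suc n) = trans (conj-* α (α ^K n)) (cong (conj α *K_) (conj-pow α n))

  conj-evalZ : ∀ cs α → conj (evalZ cs α) ≡ evalZ cs (conj α)
  conj-evalZ [] α = conj-ιQ 0ℚ
  conj-evalZ (c ∷ cs) α = begin
    conj (ιZ c +K (α *K evalZ cs α))              ≡⟨ conj-+ (ιZ c) (α *K evalZ cs α) ⟩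
    conj (ιZ c) +K conj (α *K evalZ cs α)         ≡⟨ cong₂ _+K_ (conj-ιQ (ι c)) (conj-* α (evalZ cs α)) ⟩
    ιZ c +K (conj α *K conj (evalZ cs α))         ≡⟨ cong (λ z → ιZ c +K (conj α *K z)) (conj-evalZ cs α) ⟩
    ιZ c +K (conj α *K evalZ cs (conj α))         ∎
    where open ≡-Reasoning

  conj-eval2 : ∀ ts α β → conj (eval2 ts α β) ≡ eval2 ts (conj α) (conj β)
  conj-eval2 [] α β = conj-ιQ 0ℚ
  conj-eval2 ((c , i , j) ∷ ts) α β = begin
    conj (term +K eval2 ts α β)                              ≡⟨ conj-+ term (eval2 ts α β) ⟩
    conj term +K conj (eval2 ts α β)                         ≡⟨ cong₂ _+K_ (conj-* (ιZ c) ((α ^K i) *K (β ^K j))) (conj-eval2 ts α β) ⟩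
    (conj (ιZ c) *K conj ((α ^K i) *K (β ^K j))) +K rest     ≡⟨ cong₂ (λ a b → (a *K b) +K rest) (conj-ιQ (ι c)) (conj-* (α ^K i) (β ^K j)) ⟩
    (ιZ c *K (conj (α ^K i) *K conj (β ^K j))) +K rest       ≡⟨ cong₂ (λ a b → (ιZ c *K (a *K b)) +K rest) (conj-pow α i) (conj-pow β j) ⟩
    (ιZ c *K ((conj α ^K i) *K (conj β ^K j))) +K rest       ∎
    where
    open ≡-Reasoning
    term = ιZ c *K ((α ^K i) *K (β ^K j))
    rest = eval2 ts (conj α) (conj β)

  InOK-conj : ∀ α → InOK α → InOK (conj α)
  InOK-conj α (cs , root) = cs , (begin
    (conj α ^K length cs) +K evalZ cs (conj α)        ≡⟨ cong₂ _+K_ (conj-pow α (length cs)) (conj-evalZ cs α) ⟨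
    conj (α ^K length cs) +K conj (evalZ cs α)        ≡⟨ conj-+ (α ^K length cs) (evalZ cs α) ⟨
    conj ((α ^K length cs) +K evalZ cs α)             ≡⟨ cong conj root ⟩
    conj 0K                                           ≡⟨ conj-ιQ 0ℚ ⟩
    0K                                                ∎)
    where open ≡-Reasoning

  Weil-conj : ∀ α → Weil α → Weil (conj α)
  Weil-conj α (integral , (n , norm≡n) , generates) =
    InOK-conj α integral ,
    (n , trans (NormKF-conj α) norm≡n) ,
    λ β integralβ → let (ts , eq) = generates (conj β) (InOK-conj β integralβ) in
      ts , (begin
        eval2 ts (conj α) (conj (conj α))     ≡⟨ conj-eval2 ts α (conj α) ⟨
        conj (eval2 ts α (conj α))            ≡⟨ cong conj eq ⟩
        conj (conj β)                         ≡⟨ conj-conj β ⟩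
        β                                     ∎)
    where open ≡-Reasoning

  pow-neg : ∀ x n → (-K x) ^K n ≡ ιZ (sgn n) *K (x ^K n)
  pow-neg x zero = sym (*-identityˡ 1K)
  pow-neg x (suc n) = begin
    (-K x) *K ((-K x) ^K n)                      ≡⟨ cong ((-K x) *K_) (pow-neg x n) ⟩
    (-K x) *K (ιZ (sgn n) *K (x ^K n))           ≡⟨ K-ids.neg-*-swap x (ιZ (sgn n)) (x ^K n) ⟩
    (-K ιZ (sgn n)) *K (x *K (x ^K n))           ≡⟨ cong (_*K (x *K (x ^K n))) (ιZ-neg (sgn n)) ⟨
    ιZ (ℤ.- sgn n) *K (x *K (x ^K n))            ∎
    where open ≡-Reasoning

  evalZ-alternate : ∀ s cs x → evalZ (alternate s cs) (-K x) ≡ ιZ s *K evalZ cs x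
  evalZ-alternate s [] x = sym (zeroʳ (ιZ s))
  evalZ-alternate s (c ∷ cs) x = begin
    ιZ (s ℤ.* c) +K ((-K x) *K evalZ (alternate (ℤ.- s) cs) (-K x))   ≡⟨ cong (λ z → ιZ (s ℤ.* c) +K ((-K x) *K z)) (evalZ-alternate (ℤ.- s) cs x) ⟩
    ιZ (s ℤ.* c) +K ((-K x) *K (ιZ (ℤ.- s) *K evalZ cs x))            ≡⟨ cong₂ (λ a b → a +K ((-K x) *K (b *K evalZ cs x))) (ιZ-* s c) (ιZ-neg s) ⟩
    (ιZ s *K ιZ c) +K ((-K x) *K ((-K ιZ s) *K evalZ cs x))           ≡⟨ K-ids.alternate-step (ιZ s) (ιZ c) x (evalZ cs x) ⟩
    ιZ s *K (ιZ c +K (x *K evalZ cs x))                               ∎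
    where open ≡-Reasoning

  -- if f(α) = 0 for f monic of degree n then (-1)ⁿ f(-X) is monic and vanishes at -α
  InOK-neg : ∀ α → InOK α → InOK (-K α)
  InOK-neg α (cs , root) = alternate s cs , (begin
    ((-K α) ^K length (alternate s cs)) +K evalZ (alternate s cs) (-K α)   ≡⟨ cong (λ m → ((-K α) ^K m) +K evalZ (alternate s cs) (-K α)) (length-alternate s cs) ⟩
    ((-K α) ^K n) +K evalZ (alternate s cs) (-K α)                         ≡⟨ cong₂ _+K_ (pow-neg α n) (evalZ-alternate s cs α) ⟩
    (ιZ s *K (α ^K n)) +K (ιZ s *K evalZ cs α)                             ≡⟨ distribˡ (ιZ s) (α ^K n) (evalZ cs α) ⟨
    ιZ s *K ((α ^K n) +K evalZ cs α)                                       ≡⟨ cong (ιZ s *K_) root ⟩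
    ιZ s *K 0K                                                             ≡⟨ zeroʳ (ιZ s) ⟩
    0K                                                                     ∎)
    where
    n = length cs
    s = sgn n
    open ≡-Reasoning

  eval2-neg : ∀ ts x → eval2 (alternateTerms ts) (-K x) (conj (-K x)) ≡ eval2 ts x (conj x)
  eval2-neg [] x = refl
  eval2-neg ((c , i , j) ∷ ts) x = cong₂ _+K_ (begin
    ιZ c' *K (((-K x) ^K i) *K ((-K conj x) ^K j))                         ≡⟨ cong₂ (λ a b → ιZ c' *K (a *K b)) (pow-neg x i) (pow-neg (conj x) j) ⟩
    ιZ c' *K ((ιZ (sgn i) *K (x ^K i)) *K (ιZ (sgn j) *K (conj x ^K j)))   ≡⟨ K-ids.regroup-scalars (ιZ c') (ιZ (sgn i)) (ιZ (sgn j)) (x ^K i) (conj x ^K j) ⟩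
    ((ιZ c' *K ιZ (sgn i)) *K ιZ (sgn j)) *K ((x ^K i) *K (conj x ^K j))   ≡⟨ cong (_*K ((x ^K i) *K (conj x ^K j))) coefficient ⟩
    ιZ c *K ((x ^K i) *K (conj x ^K j))                                    ∎) (eval2-neg ts x)
    where
    open ≡-Reasoning
    c' = (c ℤ.* sgn i) ℤ.* sgn j
    coefficient : (ιZ c' *K ιZ (sgn i)) *K ιZ (sgn j) ≡ ιZ c
    coefficient = begin
      (ιZ c' *K ιZ (sgn i)) *K ιZ (sgn j)    ≡⟨ cong (_*K ιZ (sgn j)) (ιZ-* c' (sgn i)) ⟨
      ιZ (c' ℤ.* sgn i) *K ιZ (sgn j)        ≡⟨ ιZ-* (c' ℤ.* sgn i) (sgn j) ⟨
      ιZ ((c' ℤ.* sgn i) ℤ.* sgn j)          ≡⟨ cong ιZ (alternate-coefficient c i j) ⟩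
      ιZ c                                   ∎

  Weil-neg : ∀ α → Weil α → Weil (-K α)
  Weil-neg α (integral , (n , norm≡n) , generates) =
    InOK-neg α integral ,
    (n , trans (NormKF-neg α) norm≡n) ,
    λ β integralβ → let (ts , eq) = generates β integralβ in
      alternateTerms ts , trans (eval2-neg ts α) eq


-- An element e of F that is integral over ℤ has N(e), Tr(e) ∈ ℤ, so that every
-- integer polynomial in e has the form p + q e with p, q ∈ ℤ.
module IntegralElements (d : ℕ) (δ : FQ) where
  open import Data.Nat as ℕ using (zero; suc)
  import Data.Nat.Properties as ℕP
  open import Data.Nat.Induction using (<-rec)
  import Data.Integer.Properties as ℤP
  open import Data.Rational as ℚ using (ℚ; 1ℚ)
  import Data.Rational.Properties as ℚP
  open import Data.List using (List; []; _∷_; length)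
  open import Relation.Nullary using (yes; no)
  open import Algebra.Properties.CommutativeSemigroup (CommutativeRing.*-commutativeSemigroup ℚP.+-*-commutativeRing)
    using (x∙yz≈y∙xz)
  open IntegersInℚ
  open CM d δ
  open CMArithmetic d δ
  open CommutativeRing F.commutativeRing
    using () renaming (zeroˡ to *F-zeroˡ; zeroʳ to *F-zeroʳ; *-identityˡ to *F-identityˡ; *-assoc to *F-assoc)
  open import Algebra.Properties.Ring (CommutativeRing.ring F.commutativeRing)
    using () renaming (-‿distribʳ-* to -F-distribʳ; +-inverseʳ-unique to -F-unique)

  1F : FQ
  1F = F.1E

  _^F_ : FQ → ℕ → FQ
  x ^F zero = 1F
  x ^F suc k = x *F (x ^F k)

  ^F-+ : ∀ x j k → x ^F (j ℕ.+ k) ≡ (x ^F j) *F (x ^F k)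
  ^F-+ x zero k = sym (*F-identityˡ (x ^F k))
  ^F-+ x (suc j) k = trans (cong (x *F_) (^F-+ x j k)) (sym (*F-assoc x (x ^F j) (x ^F k)))

  normF : FQ → ℚ
  normF = F.normE

  normF-^ : ∀ x k → normF (x ^F k) ≡ qpow (normF x) k
  normF-^ x zero = cong (λ z → 1ℚ ℚ.- z) (ℚP.*-zeroʳ dq)
  normF-^ x (suc k) = trans (F.normE-* x (x ^F k)) (cong (normF x ℚ.*_) (normF-^ x k))

  -- Bounded D x : the coordinates of x have denominators dividing D.
  -- (A record, so that bounds are compared without unfolding the rational arithmetic.)
  record Bounded (D : ℕ) (x : FQ) : Set where
    constructor bounded
    field
      bounded₁ : IsInt (ι (ℤ.+ D) ℚ.* proj₁ x)
      bounded₂ : IsInt (ι (ℤ.+ D) ℚ.* proj₂ x)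

  Bounded-0 : ∀ D → Bounded D F.0E
  Bounded-0 D = bounded (ℤ.+ 0 , ℚP.*-zeroʳ (ι (ℤ.+ D))) (ℤ.+ 0 , ℚP.*-zeroʳ (ι (ℤ.+ D)))

  Bounded-+ : ∀ D x y → Bounded D x → Bounded D y → Bounded D (x +F y)
  Bounded-+ D x y (bounded x₁ x₂) (bounded y₁ y₂) = bounded
    (subst IsInt (sym (ℚP.*-distribˡ-+ (ι (ℤ.+ D)) _ _)) (IsInt-+ x₁ y₁))
    (subst IsInt (sym (ℚP.*-distribˡ-+ (ι (ℤ.+ D)) _ _)) (IsInt-+ x₂ y₂))

  Bounded-neg : ∀ D x → Bounded D x → Bounded D (-F x)
  Bounded-neg D x (bounded x₁ x₂) = bounded
    (subst IsInt (ℚP.neg-distribʳ-* (ι (ℤ.+ D)) _) (IsInt-neg x₁))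
    (subst IsInt (ℚP.neg-distribʳ-* (ι (ℤ.+ D)) _) (IsInt-neg x₂))

  Bounded-ιF-* : ∀ D z x → Bounded D x → Bounded D (ιF z *F x)
  Bounded-ιF-* D z x (bounded x₁ x₂) = subst (Bounded D) (sym (F.ιE-scale (ι z) x)) (bounded
    (subst IsInt (x∙yz≈y∙xz (ι z) (ι (ℤ.+ D)) (proj₁ x)) (IsInt-* (z , refl) x₁))
    (subst IsInt (x∙yz≈y∙xz (ι z) (ι (ℤ.+ D)) (proj₂ x)) (IsInt-* (z , refl) x₂)))

  IsInt-multiple : ∀ D E a → IsInt (ι (ℤ.+ D) ℚ.* a) → IsInt (ι (ℤ.+ (E ℕ.* D)) ℚ.* a)
  IsInt-multiple D E a h = subst IsInt (begin
      ι (ℤ.+ E) ℚ.* (ι (ℤ.+ D) ℚ.* a)      ≡⟨ ℚP.*-assoc (ι (ℤ.+ E)) _ a ⟨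
      (ι (ℤ.+ E) ℚ.* ι (ℤ.+ D)) ℚ.* a      ≡⟨ cong (ℚ._* a) (ι-* (ℤ.+ E) (ℤ.+ D)) ⟨
      ι (ℤ.+ E ℤ.* ℤ.+ D) ℚ.* a            ≡⟨ cong (λ z → ι z ℚ.* a) (ℤP.pos-* E D) ⟨
      ι (ℤ.+ (E ℕ.* D)) ℚ.* a              ∎) (IsInt-* (ℤ.+ E , refl) h)
    where open ≡-Reasoning

  IsInt-multipleʳ : ∀ D E a → IsInt (ι (ℤ.+ D) ℚ.* a) → IsInt (ι (ℤ.+ (D ℕ.* E)) ℚ.* a)
  IsInt-multipleʳ D E a h = subst (λ n → IsInt (ι (ℤ.+ n) ℚ.* a)) (ℕP.*-comm E D) (IsInt-multiple D E a h)

  Bounded-multiple : ∀ D E x → Bounded D x → Bounded (E ℕ.* D) x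
  Bounded-multiple D E x (bounded x₁ x₂) = bounded (IsInt-multiple D E _ x₁) (IsInt-multiple D E _ x₂)

  Bounded-multipleʳ : ∀ D E x → Bounded D x → Bounded (D ℕ.* E) x
  Bounded-multipleʳ D E x (bounded x₁ x₂) = bounded (IsInt-multipleʳ D E _ x₁) (IsInt-multipleʳ D E _ x₂)

  denominatorF : FQ → ℕ
  denominatorF (a , b) = denominator a ℕ.* denominator b

  Bounded-denominatorF : ∀ x → Bounded (denominatorF x) x
  Bounded-denominatorF (a , b) = bounded
    (IsInt-multipleʳ (denominator a) (denominator b) a (IsInt-denominator a))
    (IsInt-multiple (denominator b) (denominator a) b (IsInt-denominator b))

  evalF : List ℤ → FQ → FQ
  evalF [] e = F.0E
  evalF (c ∷ cs) e = ιF c +F (e *F evalF cs e)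

  embF-^ : ∀ e k → embF e ^K k ≡ embF (e ^F k)
  embF-^ e zero = refl
  embF-^ e (suc k) = trans (cong (embF e *K_) (embF-^ e k)) (sym (K.ιE-* e (e ^F k)))

  embF-evalZ : ∀ cs e → evalZ cs (embF e) ≡ embF (evalF cs e)
  embF-evalZ [] e = refl
  embF-evalZ (c ∷ cs) e = begin
    ιZ c +K (embF e *K evalZ cs (embF e))           ≡⟨ cong (λ z → ιZ c +K (embF e *K z)) (embF-evalZ cs e) ⟩
    ιZ c +K (embF e *K embF (evalF cs e))           ≡⟨ cong (ιZ c +K_) (K.ιE-* e (evalF cs e)) ⟨
    embF (ιF c) +K embF (e *F evalF cs e)           ≡⟨ K.ιE-+ (ιF c) (e *F evalF cs e) ⟨
    embF (ιF c +F (e *F evalF cs e))                ∎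
    where open ≡-Reasoning

  monic-relation : ∀ e → InOK (embF e) → ∃[ cs ] (e ^F length cs) +F evalF cs e ≡ F.0E
  monic-relation e (cs , root) = cs , K.ιE-injective (begin
    embF ((e ^F length cs) +F evalF cs e)            ≡⟨ K.ιE-+ (e ^F length cs) (evalF cs e) ⟩
    embF (e ^F length cs) +K embF (evalF cs e)       ≡⟨ cong₂ _+K_ (embF-^ e (length cs)) (embF-evalZ cs e) ⟨
    (embF e ^K length cs) +K evalZ cs (embF e)       ≡⟨ root ⟩
    0K                                               ∎)
    where open ≡-Reasoning

  module IntegralElement (e : FQ) (cs : List ℤ) (root : (e ^F length cs) +F evalF cs e ≡ F.0E) where
    m : ℕ
    m = length cs

    Bounded-shifted : ∀ D cs' j → (∀ i → i ℕ.< length cs' → Bounded D (e ^F (j ℕ.+ i))) →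
                      Bounded D ((e ^F j) *F evalF cs' e)
    Bounded-shifted D [] j h = subst (Bounded D) (sym (*F-zeroʳ (e ^F j))) (Bounded-0 D)
    Bounded-shifted D (c ∷ cs') j h =
      subst (Bounded D) (sym (F-ids.horner-step (e ^F j) (ιF c) e (evalF cs' e)))
        (Bounded-+ D (ιF c *F (e ^F j)) ((e *F (e ^F j)) *F evalF cs' e)
          (Bounded-ιF-* D c (e ^F j) (subst (Bounded D) (cong (e ^F_) (ℕP.+-identityʳ j)) (h 0 (ℕ.s≤s ℕ.z≤n))))
          (Bounded-shifted D cs' (suc j) (λ i i<n → subst (Bounded D) (cong (e ^F_) (ℕP.+-suc j i)) (h (suc i) (ℕ.s≤s i<n)))))

    commonDenominator : ℕ → ℕ
    commonDenominator zero = 1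
    commonDenominator (suc n) = denominatorF (e ^F n) ℕ.* commonDenominator n

    commonDenominator-nonzero : ∀ n → ∃[ k ] commonDenominator n ≡ suc k
    commonDenominator-nonzero zero = 0 , refl
    commonDenominator-nonzero (suc n) with e ^F n | commonDenominator n | commonDenominator-nonzero n
    ... | (ℚ.mkℚ _ _ _ , ℚ.mkℚ _ _ _) | .(suc k) | (k , refl) = _ , refl

    Bounded-low-powers : ∀ n i → i ℕ.< n → Bounded (commonDenominator n) (e ^F i)
    Bounded-low-powers (suc n) i i<1+n with i ℕ.≟ n
    ... | yes refl = Bounded-multipleʳ (denominatorF (e ^F i)) (commonDenominator i) (e ^F i) (Bounded-denominatorF (e ^F i))
    ... | no i≢n = Bounded-multiple (commonDenominator n) (denominatorF (e ^F n)) (e ^F i)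
                     (Bounded-low-powers n i (ℕP.≤∧≢⇒< (ℕP.≤-pred i<1+n) i≢n))

    D : ℕ
    D = commonDenominator m

    e^m≡-f : e ^F m ≡ -F evalF cs e
    e^m≡-f = -F-unique (evalF cs e) (e ^F m) (trans (F.+E-comm (evalF cs e) (e ^F m)) root)

    -- all powers of e are D-bounded: e^k = -e^{k-m} f(e) reduces to lower powers
    Bounded-powers : ∀ k → Bounded D (e ^F k)
    Bounded-powers = <-rec (λ k → Bounded D (e ^F k)) step
      where
      step : ∀ k → (∀ {j} → j ℕ.< k → Bounded D (e ^F j)) → Bounded D (e ^F k)
      step k rec with k ℕ.<? m
      ... | yes k<m = Bounded-low-powers m k k<m
      ... | no k≮m = subst (Bounded D) e^k≡ (Bounded-neg D ((e ^F j) *F evalF cs e)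
            (Bounded-shifted D cs j (λ i i<m → rec (subst (j ℕ.+ i ℕ.<_) j+m≡k (ℕP.+-monoʳ-< j i<m)))))
        where
        j = k ℕ.∸ m
        j+m≡k : j ℕ.+ m ≡ k
        j+m≡k = ℕP.m∸n+n≡m (ℕP.≮⇒≥ k≮m)
        e^k≡ : -F ((e ^F j) *F evalF cs e) ≡ e ^F k
        e^k≡ = begin
          -F ((e ^F j) *F evalF cs e)    ≡⟨ -F-distribʳ (e ^F j) (evalF cs e) ⟩
          (e ^F j) *F (-F evalF cs e)    ≡⟨ cong ((e ^F j) *F_) e^m≡-f ⟨
          (e ^F j) *F (e ^F m)           ≡⟨ ^F-+ e j m ⟨
          e ^F (j ℕ.+ m)                 ≡⟨ cong (e ^F_) j+m≡k ⟩
          e ^F k                         ∎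
          where open ≡-Reasoning

    Bounded-polynomials : ∀ cs' → Bounded D (evalF cs' e)
    Bounded-polynomials cs' = subst (Bounded D) (*F-identityˡ (evalF cs' e))
      (Bounded-shifted D cs' 0 (λ i _ → Bounded-powers i))

    InZ[e] : FQ → Set
    InZ[e] x = ∃[ cs' ] evalF cs' e ≡ x

    InZ[e]-1 : InZ[e] 1F
    InZ[e]-1 = ℤ.+ 1 ∷ [] , trans (cong (1F +F_) (*F-zeroʳ e)) (F.+E-identityʳ 1F)

    InZ[e]-e* : ∀ x → InZ[e] x → InZ[e] (e *F x)
    InZ[e]-e* x (cs' , refl) = ℤ.+ 0 ∷ cs' , F.+E-identityˡ (e *F evalF cs' e)

    addPoly : List ℤ → List ℤ → List ℤ
    addPoly [] bs = bs
    addPoly (a ∷ as) [] = a ∷ as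
    addPoly (a ∷ as) (b ∷ bs) = (a ℤ.+ b) ∷ addPoly as bs

    evalF-addPoly : ∀ as bs → evalF (addPoly as bs) e ≡ evalF as e +F evalF bs e
    evalF-addPoly [] bs = sym (F.+E-identityˡ (evalF bs e))
    evalF-addPoly (a ∷ as) [] = sym (F.+E-identityʳ (evalF (a ∷ as) e))
    evalF-addPoly (a ∷ as) (b ∷ bs) = begin
      ιF (a ℤ.+ b) +F (e *F evalF (addPoly as bs) e)                   ≡⟨ cong₂ (λ x y → x +F (e *F y)) (ιF-+ a b) (evalF-addPoly as bs) ⟩
      (ιF a +F ιF b) +F (e *F (evalF as e +F evalF bs e))              ≡⟨ F-ids.horner-+ (ιF a) (ιF b) e (evalF as e) (evalF bs e) ⟩
      (ιF a +F (e *F evalF as e)) +F (ιF b +F (e *F evalF bs e))       ∎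
      where open ≡-Reasoning

    InZ[e]-+ : ∀ x y → InZ[e] x → InZ[e] y → InZ[e] (x +F y)
    InZ[e]-+ x y (as , refl) (bs , refl) = addPoly as bs , evalF-addPoly as bs

    InZ[e]-e^ : ∀ k → InZ[e] (e ^F k)
    InZ[e]-e^ zero = InZ[e]-1
    InZ[e]-e^ (suc k) = InZ[e]-e* (e ^F k) (InZ[e]-e^ k)

    InZ[e]-[e+1]^ : ∀ k → InZ[e] ((e +F 1F) ^F k)
    InZ[e]-[e+1]^ zero = InZ[e]-1
    InZ[e]-[e+1]^ (suc k) = subst InZ[e] (sym (F-ids.shift-* e ((e +F 1F) ^F k)))
      (InZ[e]-+ _ _ (InZ[e]-e* _ (InZ[e]-[e+1]^ k)) (InZ[e]-[e+1]^ k))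

    IsInt-scaled-norm : ∀ D' x → Bounded D' x → IsInt (ι (ℤ.+ (D' ℕ.* D')) ℚ.* normF x)
    IsInt-scaled-norm D' x (bounded x₁ x₂) = subst IsInt (sym (begin
      ι (ℤ.+ (D' ℕ.* D')) ℚ.* normF x                            ≡⟨ cong (λ z → ι z ℚ.* normF x) (ℤP.pos-* D' D') ⟩
      ι (ℤ.+ D' ℤ.* ℤ.+ D') ℚ.* normF x                          ≡⟨ cong (ℚ._* normF x) (ι-* (ℤ.+ D') (ℤ.+ D')) ⟩
      (r ℚ.* r) ℚ.* normF x                                      ≡⟨ ℚ-ids.scaled-norm r dq (proj₁ x) (proj₂ x) ⟩
      (r ℚ.* proj₁ x) ℚ.* (r ℚ.* proj₁ x) ℚ.- dq ℚ.* ((r ℚ.* proj₂ x) ℚ.* (r ℚ.* proj₂ x)) ∎))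
      (IsInt-+ (IsInt-* x₁ x₁) (IsInt-neg (IsInt-* (ℤ.+ d , refl) (IsInt-* x₂ x₂))))
      where
      open ≡-Reasoning
      r = ι (ℤ.+ D')

    -- N(x) ∈ ℤ for every x all of whose powers lie in ℤ[e]: the numbers N(x)^k = N(x^k)
    -- have denominators dividing D², so the integrality criterion applies.

    IsInt-norm : ∀ x → (∀ k → InZ[e] (x ^F k)) → IsInt (normF x)
    IsInt-norm x powers with commonDenominator-nonzero m
    ... | (D' , D≡1+D') = integral-if-powers-bounded (normF x) (D' ℕ.+ D' ℕ.* suc D') λ k →
      subst IsInt (cong (ι (ℤ.+ (suc D' ℕ.* suc D')) ℚ.*_) (normF-^ x k))
        (IsInt-scaled-norm (suc D') (x ^F k) (subst (λ n → Bounded n (x ^F k)) D≡1+D' (Bounded-x^ k)))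
      where
      Bounded-x^ : ∀ k → Bounded D (x ^F k)
      Bounded-x^ k = let (cs' , eq) = powers k in subst (Bounded D) eq (Bounded-polynomials cs')

    IsInt-normF : IsInt (normF e)
    IsInt-normF = IsInt-norm e InZ[e]-e^

    -- Tr(e) = N(e + 1) - N(e) - 1
    IsInt-traceF : IsInt (F.traceE e)
    IsInt-traceF = subst IsInt trace≡ (IsInt-+ (IsInt-+ (IsInt-norm (e +F 1F) InZ[e]-[e+1]^) (IsInt-neg IsInt-normF))
                                              (IsInt-neg (ℤ.+ 1 , refl)))
      where
      norm-shift : normF (e +F 1F) ≡ (normF e ℚ.+ F.traceE e) ℚ.+ 1ℚ
      norm-shift = F.ιE-injective (begin
        F.ιE (normF (e +F 1F))                              ≡⟨ F.*E-conjE (e +F 1F) ⟨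
        (e +F 1F) *F F.conjE (e +F 1F)                      ≡⟨ cong ((e +F 1F) *F_) (trans (F.conjE-+ e 1F) (cong (F.conjE e +F_) (F.conjE-ιE 1ℚ))) ⟩
        (e +F 1F) *F (F.conjE e +F 1F)                      ≡⟨ F-ids.norm-shift e (F.conjE e) ⟩
        ((e *F F.conjE e) +F (e +F F.conjE e)) +F 1F        ≡⟨ cong₂ (λ a b → (a +F b) +F 1F) (F.*E-conjE e) (F.+E-conjE e) ⟩
        (F.ιE (normF e) +F F.ιE (F.traceE e)) +F F.ιE 1ℚ    ≡⟨ cong (_+F F.ιE 1ℚ) (F.ιE-+ (normF e) (F.traceE e)) ⟨
        F.ιE (normF e ℚ.+ F.traceE e) +F F.ιE 1ℚ            ≡⟨ F.ιE-+ (normF e ℚ.+ F.traceE e) 1ℚ ⟨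
        F.ιE ((normF e ℚ.+ F.traceE e) ℚ.+ 1ℚ)              ∎)
        where open ≡-Reasoning
      trace≡ : (normF (e +F 1F) ℚ.+ ℚ.- normF e) ℚ.+ ℚ.- 1ℚ ≡ F.traceE e
      trace≡ = trans (cong (λ z → (z ℚ.+ ℚ.- normF e) ℚ.+ ℚ.- 1ℚ) norm-shift)
                     (ℚ-ids.cancel-shift (normF e) (F.traceE e) 1ℚ)

    -- Since e² = Tr(e) e - N(e) with N(e), Tr(e) ∈ ℤ, we have ℤ[e] = ℤ + ℤe.
    linear-form : ∀ cs' → ∃[ p ] ∃[ q ] evalF cs' e ≡ ιF p +F (ιF q *F e)
    linear-form [] = ℤ.+ 0 , ℤ.+ 0 , sym (trans (cong (F.0E +F_) (*F-zeroˡ e)) (F.+E-identityˡ F.0E))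
    linear-form (c ∷ cs') = c ℤ.+ ℤ.- (q ℤ.* n) , p ℤ.+ q ℤ.* t , (begin
      ιF c +F (e *F evalF cs' e)                                          ≡⟨ cong (λ z → ιF c +F (e *F z)) eq ⟩
      ιF c +F (e *F (ιF p +F (ιF q *F e)))                                ≡⟨ F-ids.cayley-hamilton (ιF c) (ιF p) (ιF q) e ē ⟩
      (ιF c +F (-F (ιF q *F (e *F ē)))) +F ((ιF p +F (ιF q *F (e +F ē))) *F e)
                                                                          ≡⟨ cong₂ (λ a b → (ιF c +F (-F (ιF q *F a))) +F ((ιF p +F (ιF q *F b)) *F e)) e·ē≡n e+ē≡t ⟩
      (ιF c +F (-F (ιF q *F ιF n))) +F ((ιF p +F (ιF q *F ιF t)) *F e)   ≡⟨ cong₂ (λ a b → a +F (b *F e)) constant linear ⟨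
      ιF (c ℤ.+ ℤ.- (q ℤ.* n)) +F (ιF (p ℤ.+ q ℤ.* t) *F e)              ∎)
      where
      open ≡-Reasoning
      p = proj₁ (linear-form cs')
      q = proj₁ (proj₂ (linear-form cs'))
      eq = proj₂ (proj₂ (linear-form cs'))
      n = proj₁ IsInt-normF
      N≡n = proj₂ IsInt-normF
      t = proj₁ IsInt-traceF
      T≡t = proj₂ IsInt-traceF
      ē = F.conjE e
      e·ē≡n : e *F ē ≡ ιF n
      e·ē≡n = trans (F.*E-conjE e) (cong F.ιE N≡n)
      e+ē≡t : e +F ē ≡ ιF t
      e+ē≡t = trans (F.+E-conjE e) (cong F.ιE T≡t)
      constant : ιF (c ℤ.+ ℤ.- (q ℤ.* n)) ≡ ιF c +F (-F (ιF q *F ιF n))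
      constant = trans (ιF-+ c (ℤ.- (q ℤ.* n))) (cong (ιF c +F_) (trans (ιF-neg (q ℤ.* n)) (cong -F_ (ιF-* q n))))
      linear : ιF (p ℤ.+ q ℤ.* t) ≡ ιF p +F (ιF q *F ιF t)
      linear = trans (ιF-+ p (q ℤ.* t)) (cong (ιF p +F_) (ιF-* q t))


module GeneratorsOfOF (d : ℕ) (δ : FQ) where
  import Data.Integer.Properties as ℤP
  import Data.Nat.Properties as ℕP
  open import Data.Rational as ℚ using (ℚ; 0ℚ; 1ℚ)
  import Data.Rational.Properties as ℚP
  open import Data.Sum using (_⊎_; inj₁; inj₂)
  open import Data.List using ([]; _∷_)
  open IntegersInℚ
  open CM d δ
  open CMArithmetic d δ
  open IntegralElements d δ

  linear-form : ∀ e → InOK (embF e) → ∀ cs → ∃[ p ] ∃[ q ] evalF cs e ≡ ιF p +F (ιF q *F e)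
  linear-form e integral = let (cs , root) = monic-relation e integral in
    IntegralElement.linear-form e cs root

  coordinate₂-linear : ∀ p q x → proj₂ (ιF p +F (ιF q *F x)) ≡ ι q ℚ.* proj₂ x
  coordinate₂-linear p q x = trans (cong (λ y → 0ℚ ℚ.+ proj₂ y) (F.ιE-scale (ι q) x)) (ℚP.+-identityˡ _)

  Generates : FQ → Set
  Generates e = GeneratesOF (embF e)

  in-ℤ+ℤe : ∀ e β → Generates e → InOF β → ∃[ p ] ∃[ q ] proj₁ β ≡ ιF p +F (ιF q *F e)
  in-ℤ+ℤe e β ((_ , integral) , generates) β∈𝒪 =
    let (cs , eq) = generates β β∈𝒪
        (p , q , eq′) = linear-form e integral cs
    in p , q , trans (sym (cong proj₁ (trans (sym (embF-evalZ cs e)) eq))) eq′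

  √d∈𝒪F : InOF (embF F.√c)
  √d∈𝒪F = refl , (ℤ.- ℤ.+ d ∷ ℤ.+ 0 ∷ []) , (begin
    (√d *K (√d *K 1K)) +K (ιZ (ℤ.- ℤ.+ d) +K (√d *K (0K +K (√d *K 0K))))  ≡⟨ cong (λ z → (√d *K (√d *K 1K)) +K (z +K (√d *K (0K +K (√d *K 0K))))) (ιZ-neg (ℤ.+ d)) ⟩
    (√d *K (√d *K 1K)) +K ((-K ιZ (ℤ.+ d)) +K (√d *K (0K +K (√d *K 0K)))) ≡⟨ K-ids.square-root-relation √d (ιZ (ℤ.+ d)) ⟩
    (√d *K √d) -K ιZ (ℤ.+ d)                                                ≡⟨ cong (_-K ιZ (ℤ.+ d)) (trans (sym (K.ιE-* F.√c F.√c)) (cong embF F.√c-squared)) ⟩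
    ιZ (ℤ.+ d) -K ιZ (ℤ.+ d)                                                ≡⟨ K.-E-inverseʳ (ιZ (ℤ.+ d)) ⟩
    0K                                                                      ∎)
    where
    open ≡-Reasoning
    √d = embF F.√c

  -- a generator of 𝒪_F is not rational: otherwise √d = p + q e would be rational
  generator-irrational : ∀ e → Generates e → proj₂ e ≢ 0ℚ
  generator-irrational e generates e₂≡0 = ℚP.1≢0 (begin
    1ℚ                                ≡⟨ cong proj₂ √d≡ ⟩
    proj₂ (ιF p +F (ιF q *F e))       ≡⟨ coordinate₂-linear p q e ⟩
    ι q ℚ.* proj₂ e                   ≡⟨ cong (ι q ℚ.*_) e₂≡0 ⟩
    ι q ℚ.* 0ℚ                        ≡⟨ ℚP.*-zeroʳ (ι q) ⟩
    0ℚ                                ∎)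
    where
    open ≡-Reasoning
    p = proj₁ (in-ℤ+ℤe e (embF F.√c) generates √d∈𝒪F)
    q = proj₁ (proj₂ (in-ℤ+ℤe e (embF F.√c) generates √d∈𝒪F))
    √d≡ = proj₂ (proj₂ (in-ℤ+ℤe e (embF F.√c) generates √d∈𝒪F))

  ∣q∣≡1 : ∀ q → ℤ.∣ q ∣ ≡ 1 → q ≡ ℤ.+ 1 ⊎ q ≡ ℤ.- ℤ.+ 1
  ∣q∣≡1 (ℤ.+ 1) _ = inj₁ refl
  ∣q∣≡1 ℤ.-[1+ 0 ] _ = inj₂ refl

  -- if e' = p + q e and e = p' + q' e' with e irrational, then q q' = 1, so q = ±1
  coefficient-unit : ∀ e e' p q p′ q′ → proj₂ e ≢ 0ℚ →
    e' ≡ ιF p +F (ιF q *F e) → e ≡ ιF p′ +F (ιF q′ *F e') → q ≡ ℤ.+ 1 ⊎ q ≡ ℤ.- ℤ.+ 1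
  coefficient-unit e e' p q p′ q′ e₂≢0 e'≡ e≡ = ∣q∣≡1 q
    (ℕP.m*n≡1⇒n≡1 ℤ.∣ q′ ∣ ℤ.∣ q ∣ (trans (sym (ℤP.abs-* q′ q)) (cong ℤ.∣_∣ q′q≡1)))
    where
    open ≡-Reasoning
    e₂≡ : proj₂ e ≡ ι (q′ ℤ.* q) ℚ.* proj₂ e
    e₂≡ = begin
      proj₂ e                              ≡⟨ cong proj₂ e≡ ⟩
      proj₂ (ιF p′ +F (ιF q′ *F e'))       ≡⟨ coordinate₂-linear p′ q′ e' ⟩
      ι q′ ℚ.* proj₂ e'                    ≡⟨ cong (λ z → ι q′ ℚ.* proj₂ z) e'≡ ⟩
      ι q′ ℚ.* proj₂ (ιF p +F (ιF q *F e)) ≡⟨ cong (ι q′ ℚ.*_) (coordinate₂-linear p q e) ⟩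
      ι q′ ℚ.* (ι q ℚ.* proj₂ e)           ≡⟨ ℚP.*-assoc (ι q′) (ι q) (proj₂ e) ⟨
      (ι q′ ℚ.* ι q) ℚ.* proj₂ e           ≡⟨ cong (ℚ._* proj₂ e) (ι-* q′ q) ⟨
      ι (q′ ℤ.* q) ℚ.* proj₂ e             ∎
    q′q≡1 : q′ ℤ.* q ≡ ℤ.+ 1
    q′q≡1 = ι-injective (*-cancelʳ (ι (q′ ℤ.* q)) 1ℚ (proj₂ e) e₂≢0
                           (trans (sym e₂≡) (sym (ℚP.*-identityˡ (proj₂ e)))))

  generators-related : ∀ e e' → Generates e → Generates e' →
    (∃[ p ] embF e' ≡ embF e +K ιZ p) ⊎ (∃[ p ] embF e' ≡ (-K embF e) +K ιZ p)
  generators-related e e' generates generates' =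
    sign-cases (coefficient-unit e e' p q (proj₁ P′) (proj₁ (proj₂ P′)) (generator-irrational e generates) e'≡ (proj₂ (proj₂ P′)))
    where
    open CommutativeRing F.commutativeRing using () renaming (*-identityˡ to *F-identityˡ)
    open import Algebra.Properties.Ring (CommutativeRing.ring F.commutativeRing) using (-1*x≈-x)
    P  = in-ℤ+ℤe e (embF e') generates (proj₁ generates')
    P′ = in-ℤ+ℤe e' (embF e) generates' (proj₁ generates)
    p = proj₁ P
    q = proj₁ (proj₂ P)
    e'≡ : e' ≡ ιF p +F (ιF q *F e)
    e'≡ = proj₂ (proj₂ P)
    shift : ∀ x → embF (ιF p +F x) ≡ embF x +K ιZ p
    shift x = trans (K.ιE-+ (ιF p) x) (K.+E-comm (ιZ p) (embF x))
    sign-cases : q ≡ ℤ.+ 1 ⊎ q ≡ ℤ.- ℤ.+ 1 →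
      (∃[ p ] embF e' ≡ embF e +K ιZ p) ⊎ (∃[ p ] embF e' ≡ (-K embF e) +K ιZ p)
    sign-cases (inj₁ q≡1) = inj₁ (p , trans (cong embF (trans e'≡ (cong (ιF p +F_) one-*))) (shift e))
      where
      one-* : ιF q *F e ≡ e
      one-* = trans (cong (λ z → ιF z *F e) q≡1) (*F-identityˡ e)
    sign-cases (inj₂ q≡-1) = inj₂ (p , trans (cong embF (trans e'≡ (cong (ιF p +F_) minus-one-*))) (shift (-F e)))
      where
      minus-one-* : ιF q *F e ≡ -F e
      minus-one-* = trans (cong (λ z → ιF z *F e) q≡-1) (trans (cong (_*F e) (ιF-neg (ℤ.+ 1))) (-1*x≈-x e))


module NormalisingConstant (d : ℕ) (δ : FQ) (γ : KQ) where
  open import Data.Rational as ℚ using (ℚ; 0ℚ; 1ℚ)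
  import Data.Rational.Properties as ℚP
  open IntegersInℚ
  open CM d δ
  open CMArithmetic d δ
  open import Algebra.Properties.Ring (CommutativeRing.ring ℚP.+-*-commutativeRing) using (+-cancelˡ)
  open CommutativeRing F.commutativeRing using () renaming (zeroʳ to *F-zeroʳ)

  candidate : KQ → KQ → ℚ → KQ
  candidate u η s = Ω γ u η +K half (ιQ s)

  -- π z : the √d-coordinate of the F-component of z; π is additive and vanishes on ℚ
  -- (both definitionally), and is ℚ-linear
  π : KQ → ℚ
  π z = proj₂ (proj₁ z)

  π-scale : ∀ t z → π (ιQ t *K z) ≡ t ℚ.* π z
  π-scale t z = trans (cong (λ w → proj₂ (proj₁ w)) (K.ιE-scale (F.ιE t) z)) (cong proj₂ (F.ιE-scale t (proj₁ z)))

  -- u (γ - γ̄) has F-component 0 when u ∈ F, so π Ω(u, η) = π η / 2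
  π-Ω : ∀ u η → π (Ω γ (embF u) η) ≡ ½ ℚ.* π η
  π-Ω u η = begin
    π (ιQ ½ *K ((embF u *K (γ -K conj γ)) +K η))          ≡⟨ π-scale ½ ((embF u *K (γ -K conj γ)) +K η) ⟩
    ½ ℚ.* (π (embF u *K (γ -K conj γ)) ℚ.+ π η)           ≡⟨ cong (λ z → ½ ℚ.* (z ℚ.+ π η)) imaginary ⟩
    ½ ℚ.* (0ℚ ℚ.+ π η)                                    ≡⟨ cong (½ ℚ.*_) (ℚP.+-identityˡ (π η)) ⟩
    ½ ℚ.* π η                                             ∎
    where
    open ≡-Reasoning
    imaginary : π (embF u *K (γ -K conj γ)) ≡ 0ℚ
    imaginary = begin
      π (embF u *K (γ -K conj γ))                       ≡⟨ cong (λ w → π (embF u *K w)) (K.-E-conjE γ) ⟩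
      π (embF u *K (F.0E , proj₂ γ +F proj₂ γ))        ≡⟨ cong π (K.ιE-scale u (F.0E , proj₂ γ +F proj₂ γ)) ⟩
      proj₂ (u *F F.0E)                                 ≡⟨ cong proj₂ (*F-zeroʳ u) ⟩
      0ℚ                                                ∎

  π-norm-shift : ∀ β s → π (NormKF (β +K half (ιQ s))) ≡ π (NormKF β) ℚ.+ s ℚ.* π β
  π-norm-shift β s = begin
    π (NormKF (β +K half (ιQ s)))                                       ≡⟨ cong (λ z → π (NormKF (β +K z))) (ιQ-* ½ s) ⟨
    π ((β +K t) *K conj (β +K t))                                       ≡⟨ cong (λ z → π ((β +K t) *K z)) (trans (conj-+ β t) (cong (conj β +K_) (conj-ιQ (½ ℚ.* s)))) ⟩
    π ((β +K t) *K (conj β +K t))                                       ≡⟨ cong π (K-ids.norm-expansion β (conj β) t) ⟩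
    π (((β *K conj β) +K (t *K (β +K conj β))) +K (t *K t))             ≡⟨ cong (λ z → π (((β *K conj β) +K (t *K z)) +K (t *K t))) (K.+E-conjE β) ⟩
    π (((β *K conj β) +K (t *K embF (K.traceE β))) +K (t *K t))         ≡⟨ cong (λ z → π (((β *K conj β) +K (t *K embF (K.traceE β))) +K z)) (ιQ-* (½ ℚ.* s) (½ ℚ.* s)) ⟨
    (π (NormKF β) ℚ.+ π (t *K embF (K.traceE β))) ℚ.+ 0ℚ                 ≡⟨ ℚP.+-identityʳ (π (NormKF β) ℚ.+ π (t *K embF (K.traceE β))) ⟩
    π (NormKF β) ℚ.+ π (t *K embF (K.traceE β))                         ≡⟨ cong (π (NormKF β) ℚ.+_) (π-scale (½ ℚ.* s) (embF (K.traceE β))) ⟩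
    π (NormKF β) ℚ.+ (½ ℚ.* s) ℚ.* (π β ℚ.+ π β)                         ≡⟨ cong (π (NormKF β) ℚ.+_) (ℚ-ids.halve-double ½ s (π β)) ⟩
    π (NormKF β) ℚ.+ s ℚ.* (1ℚ ℚ.* π β)                                  ≡⟨ cong (λ z → π (NormKF β) ℚ.+ s ℚ.* z) (ℚP.*-identityˡ (π β)) ⟩
    π (NormKF β) ℚ.+ s ℚ.* π β                                           ∎
    where
    open ≡-Reasoning
    t = ιQ (½ ℚ.* s)

  normalising-unique : ∀ β s₁ s₂ → π β ≢ 0ℚ →
    InQ (NormKF (β +K half (ιQ s₁))) → InQ (NormKF (β +K half (ιQ s₂))) → s₁ ≡ s₂
  normalising-unique β s₁ s₂ πβ≢0 (q₁ , N₁≡q₁) (q₂ , N₂≡q₂) =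
    *-cancelʳ s₁ s₂ (π β) πβ≢0 (+-cancelˡ (π (NormKF β)) (s₁ ℚ.* π β) (s₂ ℚ.* π β)
      (trans (sym (π-norm-shift β s₁)) (trans (cong π N₁≡q₁) (trans (sym (cong π N₂≡q₂)) (π-norm-shift β s₂)))))

  conj-candidate : ∀ u η s → InF u → InF η → conj (candidate u η s) ≡ candidate (-K u) η s
  conj-candidate (u , _) (η , _) s refl refl = begin
    conj (Ω γ (embF u) (embF η) +K half (ιQ s))                 ≡⟨ conj-+ (Ω γ (embF u) (embF η)) (half (ιQ s)) ⟩
    conj (Ω γ (embF u) (embF η)) +K conj (half (ιQ s))          ≡⟨ cong₂ _+K_ (conj-Ω γ u η) (trans (conj-* (ιQ ½) (ιQ s)) (cong₂ _*K_ (conj-ιQ ½) (conj-ιQ s))) ⟩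
    Ω γ (-K embF u) (embF η) +K half (ιQ s)                     ∎
    where open ≡-Reasoning

  neg-candidate : ∀ u η s p → -K candidate u η s ≡ candidate (-K u) ((-K η) +K ιZ p) ((ℚ.- s) ℚ.- ι p)
  neg-candidate u η s p = begin
    -K ((h *K ((u *K w) +K η)) +K (h *K ιQ s))                                  ≡⟨ K-ids.negate-candidate h u w η (ιZ p) (ιQ s) ⟩
    (h *K (((-K u) *K w) +K ((-K η) +K ιZ p))) +K (h *K ((-K ιQ s) +K (-K ιZ p))) ≡⟨ cong (λ z → (h *K (((-K u) *K w) +K ((-K η) +K ιZ p))) +K (h *K z)) S≡ ⟨
    (h *K (((-K u) *K w) +K ((-K η) +K ιZ p))) +K (h *K ιQ ((ℚ.- s) ℚ.- ι p))   ∎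
    where
    open ≡-Reasoning
    h = ιQ ½
    w = γ -K conj γ
    S≡ : ιQ ((ℚ.- s) ℚ.- ι p) ≡ (-K ιQ s) +K (-K ιZ p)
    S≡ = trans (ιQ-+ (ℚ.- s) (ℚ.- ι p)) (cong₂ _+K_ (ιQ-neg s) (ιQ-neg (ι p)))


module MainArgument (d : ℕ) (δ : FQ) where
  open import Data.Rational as ℚ using (ℚ; 0ℚ)
  import Data.Rational.Properties as ℚP
  open import Data.Sum using (_⊎_; inj₁; inj₂)
  open IntegersInℚ
  open CM d δ
  open CMArithmetic d δ
  open WeilSymmetries d δ
  open GeneratorsOfOF d δ
  open import Algebra.Properties.Ring (CommutativeRing.ring K.commutativeRing) using () renaming (-‿involutive to -K-involutive)

  F-element : ∀ x → InF x → x ≡ embF (proj₁ x)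
  F-element (x , _) refl = refl

  UnitF-neg : ∀ u → UnitF u → UnitF (-K u)
  UnitF-neg u ((u∈F , u∈𝒪) , (v , (v∈F , v∈𝒪) , uv≡1)) =
    (cong -F_ u∈F , InOK-neg u u∈𝒪) , (-K v , (cong -F_ v∈F , InOK-neg v v∈𝒪) , trans (K-ids.neg-*-neg u v) uv≡1)

  -- γ, T and A as in the theorem; only these properties of them are used
  module _ (γ : KQ) (T : KQ → Set)
           (generators : ∀ η → T η → GeneratesOF η)
           (unique : ∀ η η' → T η → T η' → (∃[ n ] η ≡ η' +K ιZ n) → η ≡ η')
           (A : KQ → KQ → ℚ)
           (normalised : ∀ u η → UnitF u → T η → InQ (NormKF (αf γ A u η))) where
    open NormalisingConstant d δ γ

    η-in-F : ∀ η → T η → InF η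
    η-in-F η Tη = proj₁ (proj₁ (generators η Tη))

    -- the elements of T are irrational, hence so is Ω(u, η)
    π-Ω≢0 : ∀ u η → UnitF u → T η → π (Ω γ u η) ≢ 0ℚ
    π-Ω≢0 u η unit Tη πΩ≡0 = generator-irrational (proj₁ η)
      (subst GeneratesOF (F-element η (η-in-F η Tη)) (generators η Tη))
      (*-cancelʳ (π η) 0ℚ ½ (λ ()) (trans (ℚP.*-comm (π η) ½)
        (trans (sym (π-Ω (proj₁ u) η)) (trans (cong (λ z → π (Ω γ z η)) (sym (F-element u (proj₁ (proj₁ unit))))) πΩ≡0))))

    α-determined : ∀ u η s → UnitF u → T η → InQ (NormKF (candidate u η s)) → αf γ A u η ≡ candidate u η s
    α-determined u η s unit Tη rational = cong (candidate u η)
      (normalising-unique (Ω γ u η) (A u η) s (π-Ω≢0 u η unit Tη) (normalised u η unit Tη) rational)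

    Weil-if-candidate : ∀ u η s β → UnitF u → T η → candidate u η s ≡ β → Weil β → InQ (NormKF β) → Weil (αf γ A u η)
    Weil-if-candidate u η s β unit Tη c≡β weil rational = subst Weil (sym (trans (α-determined u η s unit Tη
      (subst InQ (cong NormKF (sym c≡β)) rational)) c≡β)) weil

    module _ (u η : KQ) (unit : UnitF u) (Tη : T η) (weil : Weil (αf γ A u η)) where
      α = αf γ A u η
      a = A u η
      u∈F = proj₁ (proj₁ unit)

      Nα : InQ (NormKF α)
      Nα = normalised u η unit Tη

      -- α(-u, η) = ᾱ
      Weil-same-η : ∀ u' → u' ≡ u ⊎ u' ≡ -K u → Weil (αf γ A u' η)
      Weil-same-η u' (inj₁ refl) = weil
      Weil-same-η u' (inj₂ refl) = Weil-if-candidate (-K u) η a (conj α) (UnitF-neg u unit) Tη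
        (sym (conj-candidate u η a u∈F (η-in-F η Tη))) (Weil-conj α weil) (subst InQ (sym (NormKF-conj α)) Nα)

      -- α(u, -η + p) = -ᾱ and α(-u, -η + p) = -α
      Weil-reflected-η : ∀ p u' → T ((-K η) +K ιZ p) → u' ≡ u ⊎ u' ≡ -K u → Weil (αf γ A u' ((-K η) +K ιZ p))
      Weil-reflected-η p u' Tη' (inj₁ refl) = Weil-if-candidate u η' s' (-K conj α) unit Tη'
        candidate≡-ᾱ (Weil-neg (conj α) (Weil-conj α weil)) (subst InQ (sym N≡) Nα)
        where
        η' = (-K η) +K ιZ p
        s' = (ℚ.- a) ℚ.- ι p
        candidate≡-ᾱ : candidate u η' s' ≡ -K conj α
        candidate≡-ᾱ = begin
          candidate u η' s'                ≡⟨ cong (λ z → candidate z η' s') (-K-involutive u) ⟨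
          candidate (-K (-K u)) η' s'      ≡⟨ neg-candidate (-K u) η a p ⟨
          -K candidate (-K u) η a          ≡⟨ cong -K_ (conj-candidate u η a u∈F (η-in-F η Tη)) ⟨
          -K conj α                        ∎
          where open ≡-Reasoning
        N≡ : NormKF (-K conj α) ≡ NormKF α
        N≡ = trans (NormKF-neg (conj α)) (NormKF-conj α)
      Weil-reflected-η p u' Tη' (inj₂ refl) = Weil-if-candidate (-K u) ((-K η) +K ιZ p) ((ℚ.- a) ℚ.- ι p) (-K α)
        (UnitF-neg u unit) Tη' (sym (neg-candidate u η a p)) (Weil-neg α weil) (subst InQ (sym (NormKF-neg α)) Nα)

      -- every η' ∈ T is η or -η + p
      Weil-all : ∀ u' η' → u' ≡ u ⊎ u' ≡ -K u → T η' → Weil (αf γ A u' η')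
      Weil-all u' η' hu Tη' = cases (generators-related (proj₁ η) (proj₁ η') (generator η Tη) (generator η' Tη'))
        where
        generator : ∀ η → T η → GeneratesOF (embF (proj₁ η))
        generator η Tη = subst GeneratesOF (F-element η (η-in-F η Tη)) (generators η Tη)
        η≡ : η ≡ embF (proj₁ η)
        η≡ = F-element η (η-in-F η Tη)
        η'≡ : η' ≡ embF (proj₁ η')
        η'≡ = F-element η' (η-in-F η' Tη')
        cases : (∃[ p ] embF (proj₁ η') ≡ embF (proj₁ η) +K ιZ p) ⊎ (∃[ p ] embF (proj₁ η') ≡ (-K embF (proj₁ η)) +K ιZ p) →
                Weil (αf γ A u' η')
        cases (inj₁ (p , shifted)) = subst (λ z → Weil (αf γ A u' z))
          (sym (unique η' η Tη' Tη (p , trans η'≡ (trans shifted (cong (_+K ιZ p) (sym η≡)))))) (Weil-same-η u' hu)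
        cases (inj₂ (p , reflected)) = subst (λ z → Weil (αf γ A u' z)) (sym η'≡-η+p)
          (Weil-reflected-η p u' (subst T η'≡-η+p Tη') hu)
          where
          η'≡-η+p : η' ≡ (-K η) +K ιZ p
          η'≡-η+p = trans η'≡ (trans reflected (cong (λ z → (-K z) +K ιZ p) (sym η≡)))


open import Data.Nat using (ℕ; _≤_; _*_)
open import Data.Rational using (ℚ; 0ℚ; _<_) renaming (_*_ to _*q_)
open import Data.Product using (_×_; _,_; proj₁; proj₂)
open import Data.Sum using (_⊎_; inj₁)
open import Relation.Binary.PropositionalEquality using (_≡_; _≢_; refl)

lemma5p4 : (d : ℕ) (δ : FQ)
    → 2 ≤ d → (∀ m → m * m ≢ d)
    → proj₁ δ < 0ℚ
    → CM.dq d δ *q (proj₂ δ *q proj₂ δ) < proj₁ δ *q proj₁ δ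
    → (γ : KQ) → CM.GeneratesOKoverOF d δ γ
    → (T : KQ → Set) → CM.IsRepSet d δ T
    → (A : KQ → KQ → ℚ)
    → (∀ u η → CM.UnitF d δ u → T η
         → CM.HalfInt d δ (A u η)
         × CM.InQ d δ (CM.NormKF d δ (CM.αf d δ γ A u η)))
    → ∀ u η → CM.UnitF d δ u → T η
    → (CM.Weil d δ (CM.αf d δ γ A u η)
         → ∀ u' η' → (u' ≡ u ⊎ u' ≡ CM.-K_ d δ u) → T η' → CM.Weil d δ (CM.αf d δ γ A u' η'))
    × ((∀ u' η' → (u' ≡ u ⊎ u' ≡ CM.-K_ d δ u) → T η' → CM.Weil d δ (CM.αf d δ γ A u' η'))
         → CM.Weil d δ (CM.αf d δ γ A u η))
-- The direction ⇐ is the case u' = u, η' = η; the direction ⇒ is MainArgument.Weil-all.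
lemma5p4 d δ _ _ _ _ γ _ T (generators , _ , unique) A normalised u η unit Tη =
  (λ weil → MainArgument.Weil-all d δ γ T generators unique A rational u η unit Tη weil) ,
  (λ all-weil → all-weil u η (inj₁ refl) Tη)
  where
  rational : ∀ u η → CM.UnitF d δ u → T η → CM.InQ d δ (CM.NormKF d δ (CM.αf d δ γ A u η))
  rational u η unit Tη = proj₂ (normalised u η unit Tη)
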